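{- Let $m\ge3$ be an odd integer and let $\Gamma=C_m\square C_{2m}$. Then $\Gamma$ has at least $4m^2\cdot(2^{m+1}-3)\cdot((m-1)!)^2$ different distance magic labelings.
   Context: $\mathcal{N}_N=\{1-N,3-N,\ldots,N-1\}$. A distance magic labeling of a graph $\Gamma=(V,E)$ of order $N$ is a bijection $\ell:V\to\mathcal{N}_N$ such that for every vertex the sum of the labels of its neighbours is $0$. $C_m\square C_{2m}$ is the Cartesian product of the cycles $C_m$ and $C_{2m}$. -}

module Defs where

open import Data.Nat as ℕ using (ℕ; zero; suc; _<_; _%_; _≡ᵇ_)
open import Data.Integer as ℤ using (ℤ; +_; _-_)
open import Data.Fin using (Fin; toℕ)
open import Data.Bool using (Bool; true; false; _∨_; _∧_; if_then_else_)
open import Data.List using (List; foldr; map; allFin; cartesianProduct)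
open import Data.Product using (_×_; _,_; ∃; ∃-syntax)
open import Relation.Binary.PropositionalEquality using (_≡_)
open import Function.Definitions using (Injective)

_=ᶠ_ : ∀ {n} → Fin n → Fin n → Bool
i =ᶠ j = toℕ i ≡ᵇ toℕ j

cycleAdj : (n : ℕ) → Fin n → Fin n → Bool
cycleAdj n i j with n
... | zero  = false
... | suc k = (toℕ j ≡ᵇ (suc (toℕ i) % suc k)) ∨ (toℕ i ≡ᵇ (suc (toℕ j) % suc k))

□Adj : ∀ {A B : Set} → (A → A → Bool) → (A → A → Bool) → (B → B → Bool) → (B → B → Bool)
     → A × B → A × B → Bool
□Adj eqA adjA eqB adjB (a , b) (a' , b') = (eqA a a' ∧ adjB b b') ∨ (eqB b b' ∧ adjA a a')

V : ℕ → Set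
V m = Fin m × Fin (2 ℕ.* m)

vertices : (m : ℕ) → List (V m)
vertices m = cartesianProduct (allFin m) (allFin (2 ℕ.* m))

adj : (m : ℕ) → V m → V m → Bool
adj m = □Adj _=ᶠ_ (cycleAdj m) _=ᶠ_ (cycleAdj (2 ℕ.* m))

order : ℕ → ℕ
order m = m ℕ.* (2 ℕ.* m)

InLabelSet : ℕ → ℤ → Set
InLabelSet N z = ∃[ k ] (k < N × z ≡ (+ (2 ℕ.* k ℕ.+ 1)) - (+ N))

IsBijectionOntoLabels : (m : ℕ) → (V m → ℤ) → Set
IsBijectionOntoLabels m ℓ =
  (∀ v → InLabelSet (order m) (ℓ v)) ×
  Injective _≡_ _≡_ ℓ ×
  (∀ z → InLabelSet (order m) z → ∃[ v ] ℓ v ≡ z)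

neighbourSum : (m : ℕ) → (V m → ℤ) → V m → ℤ
neighbourSum m ℓ v = foldr ℤ._+_ (+ 0) (map (λ w → if adj m v w then ℓ w else + 0) (vertices m))

IsDistanceMagicLabeling : (m : ℕ) → (V m → ℤ) → Set
IsDistanceMagicLabeling m ℓ =
  IsBijectionOntoLabels m ℓ × (∀ v → neighbourSum m ℓ v ≡ + 0)

{-# OPTIONS --safe #-}
module Submission where

-- Write m = 2r + 1. The map (x , y) ↦ (x − y mod m, x + y mod m, parity of y) is a bijection
-- from the vertices onto ℤ_m × ℤ_m × ℤ_2, and for any G H : ℤ_m → ℤ the labeling
-- ℓ (x , y) = (−1)^y (G (x − y) + H (x + y)) has zero neighbour sums: the horizontal neighbours
-- contribute (−1)^y (G (x − y ± 1) + H (x + y ± 1)), the vertical ones the negatives of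
-- (−1)^y (G (x − y ∓ 1) + H (x + y ± 1)).
-- Taking for G the values ±a_k (k < m, one sign each) and for H the centred progression
-- σ · [−r, r], each composed with a permutation of ℤ_m, or the other way round, every label
-- is ±a_k + σ (j − r); so ℓ is a bijection onto 𝒩_{2m²} as soon as these sums tile 𝒩_{2m²},
-- and four explicit tilings are given.
-- The labeling determines G and H up to a common shift. A shifted progression determines its
-- step and the shift, and a case analysis on the steps shows that two of these labelings
-- coincide only through constant sign patterns on three of the tilings. Excluding those leaves
-- 2 · (2^m + 3 (2^m − 2)) · (m!)² = 4m²(2^(m+1) − 3)((m − 1)!)² distinct labelings.

open import Data.Nat using (ℕ; _≤_; NonZero)

module Modular (n : ℕ) .{{_ : NonZero n}} where
  open import Data.Nat as ℕ using (ℕ; _%_; NonZero)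
  import Data.Nat.Properties as ℕ
  open import Data.Nat.DivMod using (_mod_; m%n<n; m<n⇒m%n≡m; %-distribˡ-+; %-distribˡ-*; [m+n]%n≡m%n; m%n%n≡m%n)
  open import Data.Fin using (Fin; toℕ)
  open import Data.Fin.Properties using (toℕ-injective; toℕ-fromℕ<; toℕ<n; fromℕ<-cong)
  open import Relation.Binary.PropositionalEquality

  infix 4 _≈_
  _≈_ : ℕ → ℕ → Set
  a ≈ b = a % n ≡ b % n

  ≈-+ˡ : ∀ d a b → a ≈ b → d ℕ.+ a ≈ d ℕ.+ b
  ≈-+ˡ d a b a≈b = begin
    (d ℕ.+ a) % n           ≡⟨ %-distribˡ-+ d a n ⟩
    (d % n ℕ.+ a % n) % n   ≡⟨ cong (λ z → (d % n ℕ.+ z) % n) a≈b ⟩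
    (d % n ℕ.+ b % n) % n   ≡⟨ %-distribˡ-+ d b n ⟨
    (d ℕ.+ b) % n           ∎
    where open ≡-Reasoning

  ≈-+ʳ : ∀ d a b → a ≈ b → a ℕ.+ d ≈ b ℕ.+ d
  ≈-+ʳ d a b a≈b = trans (cong (_% n) (ℕ.+-comm a d)) (trans (≈-+ˡ d a b a≈b) (cong (_% n) (ℕ.+-comm d b)))

  ≈-*ˡ : ∀ d a b → a ≈ b → d ℕ.* a ≈ d ℕ.* b
  ≈-*ˡ d a b a≈b = begin
    (d ℕ.* a) % n           ≡⟨ %-distribˡ-* d a n ⟩
    (d % n ℕ.* (a % n)) % n ≡⟨ cong (λ z → (d % n ℕ.* z) % n) a≈b ⟩
    (d % n ℕ.* (b % n)) % n ≡⟨ %-distribˡ-* d b n ⟨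
    (d ℕ.* b) % n           ∎
    where open ≡-Reasoning

  %≈ : ∀ a → a % n ≈ a
  %≈ a = m%n%n≡m%n a n

  +n≈ : ∀ a → a ℕ.+ n ≈ a
  +n≈ a = [m+n]%n≡m%n a n

  mod-cong : ∀ a b → a ≈ b → a mod n ≡ b mod n
  mod-cong a b a≈b = fromℕ<-cong (a % n) (b % n) a≈b (m%n<n a n) (m%n<n b n)

  toℕ-mod : ∀ a → toℕ (a mod n) ≡ a % n
  toℕ-mod a = toℕ-fromℕ< (m%n<n a n)

  mod-toℕ : ∀ (i : Fin n) → toℕ i mod n ≡ i
  mod-toℕ i = toℕ-injective (trans (toℕ-mod (toℕ i)) (m<n⇒m%n≡m (toℕ<n i)))

module NeighbourSums where
  open import Defs
  open import Data.Nat as ℕ using (ℕ; zero; suc; _≤_; _%_; _≡ᵇ_)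
  import Data.Nat.Properties as ℕ
  open import Data.Nat.DivMod using (_mod_; m<n⇒m%n≡m; [m+n]%n≡m%n; n%n≡0)
  open import Data.Integer as ℤ using (ℤ; +_; _+_)
  import Data.Integer.Properties as ℤ
  open import Data.Fin using (Fin; zero; suc; toℕ; punchIn)
  open import Data.Vec.Functional using (removeAt)
  open import Data.Fin.Properties using (toℕ-injective; toℕ-fromℕ<; toℕ<n; punchInᵢ≢i)
  open import Data.Bool using (Bool; true; false; _∨_; _∧_; if_then_else_; T)
  open import Data.Bool.Properties using (T-∨; T-∧)
  open import Function.Bundles using (Equivalence)
  open import Data.List using (List; []; _∷_; _++_; foldr; map; tabulate; allFin; cartesianProduct)
  import Data.List.Properties as List
  open import Data.Product using (_×_; _,_)
  open import Data.Empty using (⊥-elim)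
  open import Function using (_∘_; id)
  open import Relation.Binary.PropositionalEquality
  open import Relation.Nullary using (¬_; yes; no)
  open import Data.Sum using (inj₁; inj₂)
  open import Algebra.Properties.CommutativeMonoid.Sum ℤ.+-0-commutativeMonoid
    using (sum; ∑-distrib-+; sum-cong-≗; sum-replicate-zero; sum-remove)

  when : Bool → ℤ → ℤ
  when b x = if b then x else + 0

  when-∨ : ∀ p q x → ¬ (T p × T q) → when (p ∨ q) x ≡ when p x + when q x
  when-∨ true  true  x ¬pq = ⊥-elim (¬pq (_ , _))
  when-∨ true  false x _   = sym (ℤ.+-identityʳ x)
  when-∨ false q     x _   = sym (ℤ.+-identityˡ (when q x))

  sum-zero : ∀ {n} (f : Fin n → ℤ) → (∀ i → f i ≡ + 0) → sum f ≡ + 0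
  sum-zero {n} f f≡0 = trans (sum-cong-≗ f≡0) (sum-replicate-zero n)

  sum-single : ∀ {n} (f : Fin (suc n) → ℤ) a → (∀ i → i ≢ a → f i ≡ + 0) → sum f ≡ f a
  sum-single f a vanish = begin
    sum f                          ≡⟨ sum-remove f ⟩
    f a + sum (removeAt f a)       ≡⟨ cong (λ s → f a + s) (sum-zero (removeAt f a) (λ j → vanish (punchIn a j) (punchInᵢ≢i a j))) ⟩
    f a + + 0                      ≡⟨ ℤ.+-identityʳ (f a) ⟩
    f a                            ∎
    where open ≡-Reasoning

  sum-when-unique : ∀ {n} (p : Fin n → Bool) (f : Fin n → ℤ) a →
                    (∀ i → T (p i) → i ≡ a) → T (p a) → sum (λ i → when (p i) (f i)) ≡ f a
  sum-when-unique {suc n} p f a unique pa = trans (sum-single _ a vanish) (at-a (p a) pa)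
    where
    vanish : ∀ i → i ≢ a → when (p i) (f i) ≡ + 0
    vanish i i≢a with p i in eq
    ... | true  = ⊥-elim (i≢a (unique i (subst T (sym eq) _)))
    ... | false = refl
    at-a : ∀ b → T b → when b (f a) ≡ f a
    at-a true _ = refl

  [m+n]%n≡m : ∀ {m} n .{{_ : ℕ.NonZero n}} → m ℕ.< n → (m ℕ.+ n) % n ≡ m
  [m+n]%n≡m {m} n m<n = trans ([m+n]%n≡m%n m n) (m<n⇒m%n≡m m<n)

  [2+m]%n≢m : ∀ {m n} .{{_ : ℕ.NonZero n}} → 3 ≤ n → m ℕ.< n → (2 ℕ.+ m) % n ≢ m
  [2+m]%n≢m {m} {n} 3≤n m<n eq with n ℕ.≤? 2 ℕ.+ m
  ... | no  2+m<n = ℕ.m≢1+n+m m (sym (trans (sym (m<n⇒m%n≡m (ℕ.≰⇒> 2+m<n))) eq))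
  ... | yes n≤2+m = ℕ.<⇒≢ 3≤n (sym n≡2)
    where
    e = 2 ℕ.+ m ℕ.∸ n
    e+n≡2+m : e ℕ.+ n ≡ 2 ℕ.+ m
    e+n≡2+m = ℕ.m∸n+n≡m n≤2+m
    e≡m : e ≡ m
    e≡m = begin
      e                ≡⟨ [m+n]%n≡m n (ℕ.m<n+o⇒m∸n<o (2 ℕ.+ m) n (ℕ.+-mono-≤ 3≤n (ℕ.<⇒≤ m<n))) ⟨
      (e ℕ.+ n) % n    ≡⟨ cong (_% n) e+n≡2+m ⟩
      (2 ℕ.+ m) % n    ≡⟨ eq ⟩
      m                ∎
      where open ≡-Reasoning
    n≡2 : n ≡ 2
    n≡2 = ℕ.+-cancelˡ-≡ m n 2 (trans (cong (ℕ._+ n) (sym e≡m)) (trans e+n≡2+m (ℕ.+-comm 2 m)))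

  module _ {k : ℕ} where
    open Modular (suc k)

    next prev : Fin (suc k) → Fin (suc k)
    next i = suc (toℕ i) mod suc k
    prev i = (toℕ i ℕ.+ k) mod suc k

    toℕ-next : ∀ i → toℕ (next i) ≡ suc (toℕ i) % suc k
    toℕ-next i = toℕ-fromℕ< _

    toℕ-prev : ∀ i → toℕ (prev i) ≡ (toℕ i ℕ.+ k) % suc k
    toℕ-prev i = toℕ-fromℕ< _

    prev-next : ∀ i → prev (next i) ≡ i
    prev-next i = toℕ-injective (begin
      toℕ (prev (next i))                  ≡⟨ toℕ-prev (next i) ⟩
      (toℕ (next i) ℕ.+ k) % suc k         ≡⟨ cong (λ x → (x ℕ.+ k) % suc k) (toℕ-next i) ⟩
      (suc (toℕ i) % suc k ℕ.+ k) % suc k  ≡⟨ ≈-+ʳ k (suc (toℕ i) % suc k) (suc (toℕ i)) (%≈ (suc (toℕ i))) ⟩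
      (suc (toℕ i) ℕ.+ k) % suc k          ≡⟨ cong (_% suc k) (ℕ.+-suc (toℕ i) k) ⟨
      (toℕ i ℕ.+ suc k) % suc k            ≡⟨ [m+n]%n≡m (suc k) (toℕ<n i) ⟩
      toℕ i                                ∎)
      where open ≡-Reasoning

    next-prev : ∀ i → next (prev i) ≡ i
    next-prev i = toℕ-injective (begin
      toℕ (next (prev i))                  ≡⟨ toℕ-next (prev i) ⟩
      suc (toℕ (prev i)) % suc k           ≡⟨ cong (λ x → suc x % suc k) (toℕ-prev i) ⟩
      (suc ((toℕ i ℕ.+ k) % suc k)) % suc k ≡⟨ cong (_% suc k) (ℕ.+-comm 1 _) ⟩
      ((toℕ i ℕ.+ k) % suc k ℕ.+ 1) % suc k ≡⟨ ≈-+ʳ 1 ((toℕ i ℕ.+ k) % suc k) (toℕ i ℕ.+ k) (%≈ (toℕ i ℕ.+ k)) ⟩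
      (toℕ i ℕ.+ k ℕ.+ 1) % suc k          ≡⟨ cong (_% suc k) (trans (ℕ.+-assoc (toℕ i) k 1) (cong (toℕ i ℕ.+_) (ℕ.+-comm k 1))) ⟩
      (toℕ i ℕ.+ suc k) % suc k            ≡⟨ [m+n]%n≡m (suc k) (toℕ<n i) ⟩
      toℕ i                                ∎)
      where open ≡-Reasoning

    next≢id : 1 ≤ k → ∀ i → next i ≢ i
    next≢id 1≤k i eq with ℕ.m≤n⇒m<n∨m≡n (toℕ<n i)
    ... | inj₁ 1+i<n = ℕ.1+n≢n (trans (sym (m<n⇒m%n≡m 1+i<n)) (trans (sym (toℕ-next i)) (cong toℕ eq)))
    ... | inj₂ 1+i≡n = ℕ.<⇒≢ (ℕ.s≤s 1≤k) (sym (trans (sym 1+i≡n) (cong suc i≡0)))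
      where
      i≡0 : toℕ i ≡ 0
      i≡0 = trans (sym (cong toℕ eq)) (trans (toℕ-next i) (trans (cong (_% suc k) 1+i≡n) (n%n≡0 (suc k))))

    next²≢id : 2 ≤ k → ∀ i → next (next i) ≢ i
    next²≢id 2≤k i eq = [2+m]%n≢m (ℕ.s≤s 2≤k) (toℕ<n i) (begin
      (2 ℕ.+ toℕ i) % suc k               ≡⟨ cong (_% suc k) (ℕ.+-comm 1 (suc (toℕ i))) ⟩
      (suc (toℕ i) ℕ.+ 1) % suc k         ≡⟨ ≈-+ʳ 1 (suc (toℕ i) % suc k) (suc (toℕ i)) (%≈ (suc (toℕ i))) ⟨
      (suc (toℕ i) % suc k ℕ.+ 1) % suc k ≡⟨ cong (λ x → (x ℕ.+ 1) % suc k) (toℕ-next i) ⟨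
      (toℕ (next i) ℕ.+ 1) % suc k        ≡⟨ cong (_% suc k) (ℕ.+-comm (toℕ (next i)) 1) ⟩
      suc (toℕ (next i)) % suc k          ≡⟨ toℕ-next (next i) ⟨
      toℕ (next (next i))                 ≡⟨ cong toℕ eq ⟩
      toℕ i                               ∎)
      where open ≡-Reasoning

    next-mod : ∀ a → next (a mod suc k) ≡ suc a mod suc k
    next-mod a = mod-cong (suc (toℕ (a mod suc k))) (suc a) (trans (cong (λ z → suc z % suc k) (toℕ-mod a)) (≈-+ˡ 1 (a % suc k) a (%≈ a)))

    prev-mod : ∀ a → prev (a mod suc k) ≡ (a ℕ.+ k) mod suc k
    prev-mod a = mod-cong (toℕ (a mod suc k) ℕ.+ k) (a ℕ.+ k) (trans (cong (λ z → (z ℕ.+ k) % suc k) (toℕ-mod a)) (≈-+ʳ k (a % suc k) a (%≈ a)))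

    isNext : Fin (suc k) → Fin (suc k) → Bool
    isNext i j = toℕ j ≡ᵇ suc (toℕ i) % suc k

    isNext⇒≡next : ∀ i j → T (isNext i j) → j ≡ next i
    isNext⇒≡next i j h = toℕ-injective (trans (ℕ.≡ᵇ⇒≡ _ _ h) (sym (toℕ-next i)))

    isNext-next : ∀ i → T (isNext i (next i))
    isNext-next i = ℕ.≡⇒≡ᵇ _ _ (toℕ-next i)

    cycleAdj-irrefl : 1 ≤ k → ∀ i → ¬ T (cycleAdj (suc k) i i)
    cycleAdj-irrefl 1≤k i h with T-∨ .Equivalence.to h
    ... | inj₁ p = next≢id 1≤k i (sym (isNext⇒≡next i i p))
    ... | inj₂ p = next≢id 1≤k i (sym (isNext⇒≡next i i p))

    sum-cycleAdj : 2 ≤ k → ∀ i (f : Fin (suc k) → ℤ) →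
                   sum (λ j → when (cycleAdj (suc k) i j) (f j)) ≡ f (next i) + f (prev i)
    sum-cycleAdj 2≤k i f = begin
      sum (λ j → when (isNext i j ∨ isNext j i) (f j))
        ≡⟨ sum-cong-≗ (λ j → when-∨ (isNext i j) (isNext j i) (f j) (not-both j)) ⟩
      sum (λ j → when (isNext i j) (f j) + when (isNext j i) (f j))
        ≡⟨ ∑-distrib-+ (λ j → when (isNext i j) (f j)) (λ j → when (isNext j i) (f j)) ⟩
      sum (λ j → when (isNext i j) (f j)) + sum (λ j → when (isNext j i) (f j))
        ≡⟨ cong₂ _+_ (sum-when-unique (isNext i) f (next i) (isNext⇒≡next i) (isNext-next i))
                     (sum-when-unique (λ j → isNext j i) f (prev i) isPrev prev-isNext) ⟩
      f (next i) + f (prev i) ∎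
      where
      open ≡-Reasoning
      not-both : ∀ j → ¬ (T (isNext i j) × T (isNext j i))
      not-both j (p , q) = next²≢id 2≤k i (trans (cong next (sym (isNext⇒≡next i j p))) (sym (isNext⇒≡next j i q)))
      isPrev : ∀ j → T (isNext j i) → j ≡ prev i
      isPrev j h = trans (sym (prev-next j)) (cong prev (sym (isNext⇒≡next j i h)))
      prev-isNext : T (isNext (prev i) i)
      prev-isNext = subst (λ x → T (isNext (prev i) x)) (next-prev i) (isNext-next (prev i))

  =ᶠ⇒≡ : ∀ {n} {a b : Fin n} → T (a =ᶠ b) → a ≡ b
  =ᶠ⇒≡ h = toℕ-injective (ℕ.≡ᵇ⇒≡ _ _ h)

  =ᶠ-refl : ∀ {n} (a : Fin n) → T (a =ᶠ a)
  =ᶠ-refl a = ℕ.≡⇒≡ᵇ (toℕ a) (toℕ a) refl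

  when-∧ : ∀ p q x → when (p ∧ q) x ≡ when p (when q x)
  when-∧ true  q x = refl
  when-∧ false q x = refl

  sum-when : ∀ {n} c (f : Fin n → ℤ) → sum (λ i → when c (f i)) ≡ when c (sum f)
  sum-when true  f = refl
  sum-when {n} false f = sum-zero {n} (λ _ → + 0) (λ _ → refl)

  sum-when-=ᶠ : ∀ {n} (a : Fin n) (f : Fin n → ℤ) → sum (λ i → when (a =ᶠ i) (f i)) ≡ f a
  sum-when-=ᶠ a f = sum-when-unique (a =ᶠ_) f a (λ _ h → sym (=ᶠ⇒≡ h)) (=ᶠ-refl a)

  listSum : List ℤ → ℤ
  listSum = foldr _+_ (+ 0)

  listSum-++ : ∀ xs ys → listSum (xs ++ ys) ≡ listSum xs + listSum ys
  listSum-++ []       ys = sym (ℤ.+-identityˡ _)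
  listSum-++ (x ∷ xs) ys = trans (cong (λ s → x + s) (listSum-++ xs ys)) (sym (ℤ.+-assoc x _ _))

  listSum-tabulate : ∀ {A : Set} {n} (g : Fin n → A) (F : A → ℤ) → listSum (map F (tabulate g)) ≡ sum (F ∘ g)
  listSum-tabulate {n = zero}  g F = refl
  listSum-tabulate {n = suc n} g F = cong (λ s → F (g zero) + s) (listSum-tabulate (g ∘ suc) F)

  listSum-cartesianProduct : ∀ {A B : Set} {n} (g : Fin n → A) (ys : List B) (F : A × B → ℤ) →
    listSum (map F (cartesianProduct (tabulate g) ys)) ≡ sum (λ i → listSum (map (λ y → F (g i , y)) ys))
  listSum-cartesianProduct {n = zero}  g ys F = refl
  listSum-cartesianProduct {n = suc n} g ys F = begin
    listSum (map F (map (g zero ,_) ys ++ cartesianProduct (tabulate (g ∘ suc)) ys))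
      ≡⟨ cong listSum (List.map-++ F (map (g zero ,_) ys) _) ⟩
    listSum (map F (map (g zero ,_) ys) ++ map F (cartesianProduct (tabulate (g ∘ suc)) ys))
      ≡⟨ listSum-++ (map F (map (g zero ,_) ys)) _ ⟩
    listSum (map F (map (g zero ,_) ys)) + listSum (map F (cartesianProduct (tabulate (g ∘ suc)) ys))
      ≡⟨ cong₂ _+_ (cong listSum (sym (List.map-∘ ys))) (listSum-cartesianProduct (g ∘ suc) ys F) ⟩
    sum (λ i → listSum (map (λ y → F (g i , y)) ys)) ∎
    where open ≡-Reasoning

  neighbourSum-double : ∀ m (ℓ : V m → ℤ) → ∀ v →
    neighbourSum m ℓ v ≡ sum (λ a → sum (λ b → when (adj m v (a , b)) (ℓ (a , b))))
  neighbourSum-double m ℓ v = trans (listSum-cartesianProduct id (allFin (2 ℕ.* m)) F)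
                                    (sum-cong-≗ (λ a → listSum-tabulate id (λ b → F (a , b))))
    where
    F : V m → ℤ
    F w = when (adj m v w) (ℓ w)

  neighbourSum-torus : ∀ k → 2 ≤ k → (ℓ : V (suc k) → ℤ) → ∀ a b →
    neighbourSum (suc k) ℓ (a , b) ≡ (ℓ (a , next b) + ℓ (a , prev b)) + (ℓ (next a , b) + ℓ (prev a , b))
  neighbourSum-torus k 2≤k ℓ a b = begin
    neighbourSum m ℓ (a , b)
      ≡⟨ neighbourSum-double m ℓ (a , b) ⟩
    sum (λ a' → sum (λ b' → when (P a' b' ∨ Q a' b') (ℓ (a' , b'))))
      ≡⟨ sum-cong-≗ (λ a' → sum-cong-≗ (λ b' → when-∨ (P a' b') (Q a' b') (ℓ (a' , b')) (not-both a' b'))) ⟩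
    sum (λ a' → sum (λ b' → when (P a' b') (ℓ (a' , b')) + when (Q a' b') (ℓ (a' , b'))))
      ≡⟨ sum-cong-≗ (λ a' → ∑-distrib-+ (λ b' → when (P a' b') (ℓ (a' , b'))) (λ b' → when (Q a' b') (ℓ (a' , b')))) ⟩
    sum (λ a' → sum (λ b' → when (P a' b') (ℓ (a' , b'))) + sum (λ b' → when (Q a' b') (ℓ (a' , b'))))
      ≡⟨ ∑-distrib-+ (λ a' → sum (λ b' → when (P a' b') (ℓ (a' , b')))) (λ a' → sum (λ b' → when (Q a' b') (ℓ (a' , b')))) ⟩
    sum (λ a' → sum (λ b' → when (P a' b') (ℓ (a' , b')))) + sum (λ a' → sum (λ b' → when (Q a' b') (ℓ (a' , b'))))
      ≡⟨ cong₂ _+_ vertical horizontal ⟩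
    (ℓ (a , next b) + ℓ (a , prev b)) + (ℓ (next a , b) + ℓ (prev a , b)) ∎
    where
    open ≡-Reasoning
    m = suc k
    P Q : Fin m → Fin (2 ℕ.* m) → Bool
    P a' b' = (a =ᶠ a') ∧ cycleAdj (2 ℕ.* m) b b'
    Q a' b' = (b =ᶠ b') ∧ cycleAdj m a a'
    not-both : ∀ a' b' → ¬ (T (P a' b') × T (Q a' b'))
    not-both a' b' (p , q) with T-∧ {a =ᶠ a'} .Equivalence.to p | T-∧ {b =ᶠ b'} .Equivalence.to q
    ... | a=a' , _ | _ , a~a' = cycleAdj-irrefl (ℕ.≤-trans (ℕ.s≤s ℕ.z≤n) 2≤k) a (subst (λ x → T (cycleAdj m a x)) (sym (=ᶠ⇒≡ a=a')) a~a')
    vertical : sum (λ a' → sum (λ b' → when (P a' b') (ℓ (a' , b')))) ≡ ℓ (a , next b) + ℓ (a , prev b)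
    vertical = begin
      sum (λ a' → sum (λ b' → when (P a' b') (ℓ (a' , b'))))
        ≡⟨ sum-cong-≗ (λ a' → trans (sum-cong-≗ (λ b' → when-∧ (a =ᶠ a') (cycleAdj (2 ℕ.* m) b b') (ℓ (a' , b')))) (sum-when (a =ᶠ a') (λ b' → when (cycleAdj (2 ℕ.* m) b b') (ℓ (a' , b'))))) ⟩
      sum (λ a' → when (a =ᶠ a') (sum (λ b' → when (cycleAdj (2 ℕ.* m) b b') (ℓ (a' , b')))))
        ≡⟨ sum-when-=ᶠ a (λ a' → sum (λ b' → when (cycleAdj (2 ℕ.* m) b b') (ℓ (a' , b')))) ⟩
      sum (λ b' → when (cycleAdj (2 ℕ.* m) b b') (ℓ (a , b')))
        ≡⟨ sum-cycleAdj (ℕ.≤-trans 2≤k (ℕ.m≤m+n k _)) b (λ b' → ℓ (a , b')) ⟩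
      ℓ (a , next b) + ℓ (a , prev b) ∎
    horizontal : sum (λ a' → sum (λ b' → when (Q a' b') (ℓ (a' , b')))) ≡ ℓ (next a , b) + ℓ (prev a , b)
    horizontal = begin
      sum (λ a' → sum (λ b' → when (Q a' b') (ℓ (a' , b'))))
        ≡⟨ sum-cong-≗ (λ a' → trans (sum-cong-≗ (λ b' → when-∧ (b =ᶠ b') (cycleAdj m a a') (ℓ (a' , b')))) (sum-when-=ᶠ b (λ b' → when (cycleAdj m a a') (ℓ (a' , b'))))) ⟩
      sum (λ a' → when (cycleAdj m a a') (ℓ (a' , b)))
        ≡⟨ sum-cycleAdj 2≤k a (λ a' → ℓ (a' , b)) ⟩
      ℓ (next a , b) + ℓ (prev a , b) ∎

module LabelSet where
  open import Defs
  open import Data.Nat as ℕ using (ℕ; suc; _<_)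
  import Data.Nat.Properties as ℕ
  open import Data.Nat.Tactic.RingSolver as ℕ-Solver using ()
  open import Data.Integer as ℤ using (ℤ; +_; _⊖_; _+_; _-_; -_)
  import Data.Integer.Properties as ℤ
  open import Data.Integer.Tactic.RingSolver using (solve-∀)
  open import Data.Fin as Fin using (Fin; toℕ; fromℕ<; punchOut)
  open import Data.Fin.Properties using (toℕ-fromℕ<; any?; _≟_; punchOut-injective; injective⇒≤; *↔×)
  open import Data.List using (_∷_; [])
  open import Data.Product using (_,_; proj₁; proj₂; ∃-syntax)
  open import Data.Empty using (⊥-elim)
  open import Function using (_∘_; _↔_; Inverse; Injection)
  open import Function.Properties.Inverse using (Inverse⇒Injection)
  open import Function.Definitions using (Injective)
  open import Relation.Binary.PropositionalEquality
  open import Relation.Nullary using (yes; no)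

  ⊖≡⊖⇒+≡+ : ∀ a b c d → a ⊖ b ≡ c ⊖ d → a ℕ.+ d ≡ c ℕ.+ b
  ⊖≡⊖⇒+≡+ a b c d eq = ℤ.+-injective (begin
    + (a ℕ.+ d)           ≡⟨ ℤ.pos-+ a d ⟩
    + a + + d             ≡⟨ shuffle (+ a) (+ b) (+ d) ⟩
    (+ a - + b) + (+ b + + d) ≡⟨ cong (_+ (+ b + + d)) (ℤ.[+m]-[+n]≡m⊖n a b) ⟩
    (a ⊖ b) + (+ b + + d) ≡⟨ cong (_+ (+ b + + d)) eq ⟩
    (c ⊖ d) + (+ b + + d) ≡⟨ cong (_+ (+ b + + d)) (ℤ.[+m]-[+n]≡m⊖n c d) ⟨
    (+ c - + d) + (+ b + + d) ≡⟨ unshuffle (+ c) (+ d) (+ b) ⟩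
    + c + + b             ≡⟨ ℤ.pos-+ c b ⟨
    + (c ℕ.+ b)           ∎)
    where
    open ≡-Reasoning
    shuffle : ∀ x y z → x + z ≡ (x - y) + (y + z)
    shuffle = solve-∀
    unshuffle : ∀ x z y → (x - z) + (y + z) ≡ x + y
    unshuffle = solve-∀

  +≡+⇒⊖≡⊖ : ∀ a b c d → a ℕ.+ d ≡ c ℕ.+ b → a ⊖ b ≡ c ⊖ d
  +≡+⇒⊖≡⊖ a b c d eq = begin
    a ⊖ b                         ≡⟨ ℤ.+-cancelˡ-⊖ d a b ⟨
    (d ℕ.+ a) ⊖ (d ℕ.+ b)         ≡⟨ cong₂ _⊖_ (trans (ℕ.+-comm d a) eq) (ℕ.+-comm d b) ⟩
    (c ℕ.+ b) ⊖ (b ℕ.+ d)         ≡⟨ cong (_⊖ (b ℕ.+ d)) (ℕ.+-comm c b) ⟩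
    (b ℕ.+ c) ⊖ (b ℕ.+ d)         ≡⟨ ℤ.+-cancelˡ-⊖ b c d ⟩
    c ⊖ d                         ∎
    where open ≡-Reasoning

  ⊖-+-⊖ : ∀ a b c d → (a ⊖ b) + (c ⊖ d) ≡ (a ℕ.+ c) ⊖ (b ℕ.+ d)
  ⊖-+-⊖ a b c d = begin
    (a ⊖ b) + (c ⊖ d)         ≡⟨ cong₂ _+_ (ℤ.[+m]-[+n]≡m⊖n a b) (ℤ.[+m]-[+n]≡m⊖n c d) ⟨
    (+ a - + b) + (+ c - + d) ≡⟨ regroup (+ a) (+ b) (+ c) (+ d) ⟩
    (+ a + + c) - (+ b + + d) ≡⟨ cong₂ _-_ (ℤ.pos-+ a c) (ℤ.pos-+ b d) ⟨
    + (a ℕ.+ c) - + (b ℕ.+ d) ≡⟨ ℤ.[+m]-[+n]≡m⊖n (a ℕ.+ c) (b ℕ.+ d) ⟩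
    (a ℕ.+ c) ⊖ (b ℕ.+ d)     ∎
    where
    open ≡-Reasoning
    regroup : ∀ w x y z → (w - x) + (y - z) ≡ (w + y) - (x + z)
    regroup = solve-∀

  label : ℕ → ℕ → ℤ
  label N k = + (2 ℕ.* k ℕ.+ 1) - + N

  ⊖∈labels : ∀ {N} M P Q w → N ≡ M ℕ.+ M → Q < P ℕ.+ N → P < Q ℕ.+ N →
             P ℕ.+ Q ≡ suc (2 ℕ.* w) → InLabelSet N (P ⊖ Q)
  ⊖∈labels {N} M P Q w N≡2M Q<P+N P<Q+N P+Q≡odd = x , x<N , P⊖Q≡label
    where
    t = P ℕ.+ N ℕ.∸ suc Q
    t+1+Q≡P+N : t ℕ.+ suc Q ≡ P ℕ.+ N
    t+1+Q≡P+N = ℕ.m∸n+n≡m Q<P+N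
    t+2Q≡2[w+M] : t ℕ.+ 2 ℕ.* Q ≡ 2 ℕ.* (w ℕ.+ M)
    t+2Q≡2[w+M] = ℕ.+-cancelʳ-≡ (suc Q) _ _ (begin
      t ℕ.+ 2 ℕ.* Q ℕ.+ suc Q          ≡⟨ regroup t Q ⟩
      t ℕ.+ suc Q ℕ.+ Q ℕ.+ Q          ≡⟨ cong (λ y → y ℕ.+ Q ℕ.+ Q) t+1+Q≡P+N ⟩
      P ℕ.+ N ℕ.+ Q ℕ.+ Q              ≡⟨ cong (λ y → P ℕ.+ y ℕ.+ Q ℕ.+ Q) N≡2M ⟩
      P ℕ.+ (M ℕ.+ M) ℕ.+ Q ℕ.+ Q      ≡⟨ ℕ-Solver.solve (P ∷ M ∷ Q ∷ []) ⟩
      (P ℕ.+ Q) ℕ.+ 2 ℕ.* M ℕ.+ Q      ≡⟨ cong (λ y → y ℕ.+ 2 ℕ.* M ℕ.+ Q) P+Q≡odd ⟩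
      suc (2 ℕ.* w) ℕ.+ 2 ℕ.* M ℕ.+ Q  ≡⟨ ℕ-Solver.solve (w ∷ M ∷ Q ∷ []) ⟩
      2 ℕ.* (w ℕ.+ M) ℕ.+ suc Q        ∎)
      where
      open ≡-Reasoning
      regroup : ∀ t Q → t ℕ.+ 2 ℕ.* Q ℕ.+ suc Q ≡ t ℕ.+ suc Q ℕ.+ Q ℕ.+ Q
      regroup = ℕ-Solver.solve-∀
    x = w ℕ.+ M ℕ.∸ Q
    2x≡t : 2 ℕ.* x ≡ t
    2x≡t = begin
      2 ℕ.* (w ℕ.+ M ℕ.∸ Q)        ≡⟨ ℕ.*-distribˡ-∸ 2 (w ℕ.+ M) Q ⟩
      2 ℕ.* (w ℕ.+ M) ℕ.∸ 2 ℕ.* Q  ≡⟨ cong (ℕ._∸ 2 ℕ.* Q) t+2Q≡2[w+M] ⟨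
      t ℕ.+ 2 ℕ.* Q ℕ.∸ 2 ℕ.* Q    ≡⟨ ℕ.m+n∸n≡m t (2 ℕ.* Q) ⟩
      t                            ∎
      where open ≡-Reasoning
    P+N≡2x+1+Q : P ℕ.+ N ≡ (2 ℕ.* x ℕ.+ 1) ℕ.+ Q
    P+N≡2x+1+Q = begin
      P ℕ.+ N              ≡⟨ t+1+Q≡P+N ⟨
      t ℕ.+ suc Q          ≡⟨ cong (ℕ._+ suc Q) 2x≡t ⟨
      2 ℕ.* x ℕ.+ suc Q    ≡⟨ ℕ.+-assoc (2 ℕ.* x) 1 Q ⟨
      2 ℕ.* x ℕ.+ 1 ℕ.+ Q  ∎
      where open ≡-Reasoning
    2x+1<2N : 2 ℕ.* x ℕ.+ 1 < 2 ℕ.* N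
    2x+1<2N = ℕ.+-cancelʳ-< Q _ _ (begin-strict
      2 ℕ.* x ℕ.+ 1 ℕ.+ Q  ≡⟨ P+N≡2x+1+Q ⟨
      P ℕ.+ N              <⟨ ℕ.+-monoˡ-< N P<Q+N ⟩
      Q ℕ.+ N ℕ.+ N        ≡⟨ ℕ-Solver.solve (Q ∷ N ∷ []) ⟩
      2 ℕ.* N ℕ.+ Q        ∎)
      where open ℕ.≤-Reasoning
    x<N : x < N
    x<N = ℕ.*-cancelˡ-< 2 x N (ℕ.<-trans (ℕ.m<m+n (2 ℕ.* x) (ℕ.s≤s ℕ.z≤n)) 2x+1<2N)
    P⊖Q≡label : P ⊖ Q ≡ label N x
    P⊖Q≡label = trans (+≡+⇒⊖≡⊖ P Q (2 ℕ.* x ℕ.+ 1) N P+N≡2x+1+Q) (sym (ℤ.[+m]-[+n]≡m⊖n _ N))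

  injective⇒surjective : ∀ {n} (f : Fin n → Fin n) → Injective _≡_ _≡_ f → ∀ y → ∃[ x ] f x ≡ y
  injective⇒surjective {suc n} f f-inj y with any? (λ x → f x ≟ y)
  ... | yes hit = hit
  ... | no  miss = ⊥-elim (ℕ.<-irrefl refl (injective⇒≤ {f = g} g-inj))
    where
    y≢f : ∀ x → y ≢ f x
    y≢f x y≡fx = miss (x , sym y≡fx)
    g : Fin (suc n) → Fin n
    g x = punchOut (y≢f x)
    g-inj : Injective _≡_ _≡_ g
    g-inj eq = f-inj (punchOut-injective (y≢f _) (y≢f _) eq)

  module _ {A : Set} {N} (e : Fin N ↔ A) (ℓ : A → ℤ)
           (ℓ∈labels : ∀ a → InLabelSet N (ℓ a)) (ℓ-inj : Injective _≡_ _≡_ ℓ) where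

    private
      index : A → Fin N
      index a = fromℕ< (proj₁ (proj₂ (ℓ∈labels a)))

      ℓ≡label∘index : ∀ a → ℓ a ≡ label N (toℕ (index a))
      ℓ≡label∘index a = trans (proj₂ (proj₂ (ℓ∈labels a))) (cong (label N) (sym (toℕ-fromℕ< (proj₁ (proj₂ (ℓ∈labels a))))))

      index∘to-inj : Injective _≡_ _≡_ (index ∘ Inverse.to e)
      index∘to-inj {i} {j} eq = Injection.injective (Inverse⇒Injection e) (ℓ-inj (begin
        ℓ (Inverse.to e i)                      ≡⟨ ℓ≡label∘index _ ⟩
        label N (toℕ (index (Inverse.to e i)))  ≡⟨ cong (label N ∘ toℕ) eq ⟩
        label N (toℕ (index (Inverse.to e j)))  ≡⟨ ℓ≡label∘index _ ⟨
        ℓ (Inverse.to e j)                      ∎))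
        where open ≡-Reasoning

    labels-covered : ∀ z → InLabelSet N z → ∃[ a ] ℓ a ≡ z
    labels-covered z (k , k<N , z≡label) with injective⇒surjective _ index∘to-inj (fromℕ< k<N)
    ... | i , hit = Inverse.to e i , (begin
      ℓ (Inverse.to e i)                      ≡⟨ ℓ≡label∘index _ ⟩
      label N (toℕ (index (Inverse.to e i)))  ≡⟨ cong (label N ∘ toℕ) hit ⟩
      label N (toℕ (fromℕ< k<N))              ≡⟨ cong (label N) (toℕ-fromℕ< k<N) ⟩
      label N k                               ≡⟨ z≡label ⟨
      z                                       ∎)
      where open ≡-Reasoning

  isBijectionOntoLabels : ∀ m (ℓ : V m → ℤ) → (∀ v → InLabelSet (order m) (ℓ v)) → Injective _≡_ _≡_ ℓ →
                          IsBijectionOntoLabels m ℓ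
  isBijectionOntoLabels m ℓ ℓ∈labels ℓ-inj = ℓ∈labels , ℓ-inj , labels-covered *↔× ℓ ℓ∈labels ℓ-inj

module Enumeration where
  open import Data.Nat as ℕ using (ℕ; zero; suc; _!; _<_; _≤_; z≤n; s≤s; _%_; _/_; _≡ᵇ_; _^_)
  import Data.Nat.Properties as ℕ
  open import Data.Nat.DivMod using (m%n<n; m≡m%n+[m/n]*n; m<n*o⇒m/o<n)
  open import Data.Fin as Fin using (Fin; zero; suc; punchIn; remQuot; combine)
  open import Data.Fin.Properties using (punchIn-injective; punchInᵢ≢i; combine-remQuot)
  open import Data.Product using (_×_; _,_; uncurry)
  open import Data.Sum using (_⊎_; inj₁; inj₂)
  open import Data.Bool using (Bool; true; false)
  open import Data.Empty using (⊥-elim)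
  open import Function.Definitions using (Injective)
  open import Relation.Binary.PropositionalEquality
  open import Relation.Nullary using (¬_)

  remQuot-injective : ∀ {n} k {i j : Fin (n ℕ.* k)} → remQuot {n} k i ≡ remQuot {n} k j → i ≡ j
  remQuot-injective {n} k {i} {j} eq =
    trans (sym (combine-remQuot {n} k i)) (trans (cong (uncurry combine) eq) (combine-remQuot {n} k j))

  consPerm : ∀ {n} → Fin (suc n) → (Fin n → Fin n) → Fin (suc n) → Fin (suc n)
  consPerm p π zero    = p
  consPerm p π (suc i) = punchIn p (π i)

  consPerm-injective : ∀ {n} p (π : Fin n → Fin n) → Injective _≡_ _≡_ π → Injective _≡_ _≡_ (consPerm p π)
  consPerm-injective p π π-inj {zero}  {zero}  eq = refl
  consPerm-injective p π π-inj {zero}  {suc j} eq = ⊥-elim (punchInᵢ≢i p (π j) (sym eq))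
  consPerm-injective p π π-inj {suc i} {zero}  eq = ⊥-elim (punchInᵢ≢i p (π i) eq)
  consPerm-injective p π π-inj {suc i} {suc j} eq = cong suc (π-inj (punchIn-injective p (π i) (π j) eq))

  consPerm-cancel : ∀ {n} p p' (π π' : Fin n → Fin n) → (∀ i → consPerm p π i ≡ consPerm p' π' i) →
                    p ≡ p' × (∀ i → π i ≡ π' i)
  consPerm-cancel p p' π π' eq = eq zero , λ i →
    punchIn-injective p (π i) (π' i) (trans (eq (suc i)) (cong (λ q → punchIn q (π' i)) (sym (eq zero))))

  permutation : ∀ n → Fin (n !) → Fin n → Fin n
  permutation zero    code = λ ()
  permutation (suc n) code = let (p , rest) = remQuot {suc n} (n !) code in consPerm p (permutation n rest)

  permutation-injective : ∀ n code → Injective _≡_ _≡_ (permutation n code)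
  permutation-injective (suc n) code =
    let (p , rest) = remQuot {suc n} (n !) code in consPerm-injective p _ (permutation-injective n rest)

  permutation-cancel : ∀ n code code' → (∀ i → permutation n code i ≡ permutation n code' i) → code ≡ code'
  permutation-cancel zero    zero zero _ = refl
  permutation-cancel (suc n) code code' eq with consPerm-cancel _ _ _ _ eq
  ... | heads , tails = remQuot-injective (n !) (cong₂ _,_ heads (permutation-cancel n _ _ tails))

  bit : ℕ → ℕ → Bool
  bit n zero    = n % 2 ≡ᵇ 1
  bit n (suc k) = bit (n / 2) k

  %2≡0⊎%2≡1 : ∀ n → n % 2 ≡ 0 ⊎ n % 2 ≡ 1
  %2≡0⊎%2≡1 n with n % 2 | m%n<n n 2
  ... | zero        | _ = inj₁ refl
  ... | suc zero    | _ = inj₂ refl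
  ... | suc (suc _) | s≤s (s≤s ())

  bitValue : Bool → ℕ
  bitValue false = 0
  bitValue true  = 1

  %2≡bitValue-bit : ∀ n → n % 2 ≡ bitValue (bit n 0)
  %2≡bitValue-bit n with %2≡0⊎%2≡1 n
  ... | inj₁ n%2≡0 rewrite n%2≡0 = refl
  ... | inj₂ n%2≡1 rewrite n%2≡1 = refl

  n≡bitValue+2[n/2] : ∀ n → n ≡ bitValue (bit n 0) ℕ.+ 2 ℕ.* (n / 2)
  n≡bitValue+2[n/2] n = trans (m≡m%n+[m/n]*n n 2) (cong₂ ℕ._+_ (%2≡bitValue-bit n) (ℕ.*-comm (n / 2) 2))

  /2<2^ : ∀ M {n} → n < 2 ^ suc M → n / 2 < 2 ^ M
  /2<2^ M {n} lt = m<n*o⇒m/o<n (subst (n <_) (ℕ.*-comm 2 (2 ^ M)) lt)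

  bit-injective : ∀ M {n n'} → n < 2 ^ M → n' < 2 ^ M → (∀ k → k < M → bit n k ≡ bit n' k) → n ≡ n'
  bit-injective zero    (s≤s z≤n) (s≤s z≤n) _ = refl
  bit-injective (suc M) {n} {n'} lt lt' same = begin
    n                                    ≡⟨ n≡bitValue+2[n/2] n ⟩
    bitValue (bit n 0) ℕ.+ 2 ℕ.* (n / 2)   ≡⟨ cong₂ (λ b q → bitValue b ℕ.+ 2 ℕ.* q) (same 0 (s≤s z≤n)) halves ⟩
    bitValue (bit n' 0) ℕ.+ 2 ℕ.* (n' / 2) ≡⟨ n≡bitValue+2[n/2] n' ⟨
    n'                                   ∎
    where
    open ≡-Reasoning
    halves : n / 2 ≡ n' / 2
    halves = bit-injective M (/2<2^ M lt) (/2<2^ M lt') (λ k k<M → same (suc k) (s≤s k<M))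

  bit-0 : ∀ k → bit 0 k ≡ false
  bit-0 zero    = refl
  bit-0 (suc k) = bit-0 k

  allFalse⇒≡0 : ∀ M {n} → n < 2 ^ M → (∀ k → k < M → bit n k ≡ false) → n ≡ 0
  allFalse⇒≡0 M lt all = bit-injective M lt (ℕ.m^n>0 2 M) (λ k k<M → trans (all k k<M) (sym (bit-0 k)))

  allTrue⇒≡2^-1 : ∀ M {n} → n < 2 ^ M → (∀ k → k < M → bit n k ≡ true) → suc n ≡ 2 ^ M
  allTrue⇒≡2^-1 zero    (s≤s z≤n) all = refl
  allTrue⇒≡2^-1 (suc M) {n} lt all = begin
    suc n                                  ≡⟨ cong suc (n≡bitValue+2[n/2] n) ⟩
    suc (bitValue (bit n 0) ℕ.+ 2 ℕ.* (n / 2)) ≡⟨ cong (λ b → suc (bitValue b ℕ.+ 2 ℕ.* (n / 2))) (all 0 (s≤s z≤n)) ⟩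
    2 ℕ.+ 2 ℕ.* (n / 2)                    ≡⟨ ℕ.*-suc 2 (n / 2) ⟨
    2 ℕ.* suc (n / 2)                      ≡⟨ cong (2 ℕ.*_) (allTrue⇒≡2^-1 M (/2<2^ M lt) (λ k k<M → all (suc k) (s≤s k<M))) ⟩
    2 ^ suc M                              ∎
    where open ≡-Reasoning

  bit-nonconstant : ∀ M {n} → 1 ≤ n → suc (suc n) ≤ 2 ^ M → ¬ (∀ k → k < M → bit n k ≡ bit n 0)
  bit-nonconstant M {n} 1≤n n+2≤2^M constant with bit n 0
  ... | false = ℕ.<⇒≢ 1≤n (sym (allFalse⇒≡0 M n<2^M constant))
    where n<2^M = ℕ.<-trans (ℕ.n<1+n n) n+2≤2^M
  ... | true  = ℕ.<-irrefl (allTrue⇒≡2^-1 M n<2^M constant) n+2≤2^M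
    where n<2^M = ℕ.<-trans (ℕ.n<1+n n) n+2≤2^M

module Labeling (r : ℕ) (1≤r : 1 ≤ r) where
  open import Data.Nat as ℕ using (ℕ; zero; suc; _≤_; _<_; _%_; s≤s; z≤n)
  open import Defs
  open NeighbourSums
  import Data.Nat.Properties as ℕ
  open import Data.Nat.DivMod using (_mod_; [m+kn]%n≡m%n; m∣n⇒o%n%m≡o%m; m≡m%n+[m/n]*n; m<n*o⇒m/o<n)
  open import Data.Nat.Divisibility using (n∣m*n)
  open import Algebra.Properties.CommutativeSemigroup ℕ.+-commutativeSemigroup using (xy∙z≈xz∙y)
  import Data.Nat.Tactic.RingSolver as ℕ-Solver
  open import Data.Integer as ℤ using (ℤ; +_; _+_; _*_; -_; _-_)
  import Data.Integer.Properties as ℤ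
  open import Data.Integer.Tactic.RingSolver using (solve-∀)
  open import Data.Fin using (Fin; zero; toℕ; fromℕ<)
  open import Data.Fin.Properties using (toℕ-injective; toℕ-fromℕ<; toℕ<n)
  open import Data.Bool using (Bool; true; false; not)
  open import Data.Bool.Properties using (not-involutive; not-¬)
  open import Data.Product using (_×_; _,_; proj₂; ∃-syntax)
  open import Data.Sum using (_⊎_; inj₁; inj₂)
  open import Data.Empty using (⊥-elim)
  open import Function using (_∘_)
  open import Relation.Binary.PropositionalEquality

  c m : ℕ
  c = 2 ℕ.* r
  m = suc c

  open Modular m

  %2m≈ : ∀ a → a % (2 ℕ.* m) ≈ a
  %2m≈ a = m∣n⇒o%n%m≡o%m m (2 ℕ.* m) a (n∣m*n 2)

  ≈⇒≡next : ∀ u v → u ≈ suc v → u mod m ≡ next (v mod m)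
  ≈⇒≡next u v u≈1+v = trans (mod-cong u (suc v) u≈1+v) (sym (next-mod v))

  ≈⇒≡prev : ∀ u v → u ≈ v ℕ.+ c → u mod m ≡ prev (v mod m)
  ≈⇒≡prev u v u≈v+c = trans (mod-cong u (v ℕ.+ c) u≈v+c) (sym (prev-mod v))

  even : ℕ → Bool
  even zero    = true
  even (suc n) = not (even n)

  even-+2* : ∀ a j → even (a ℕ.+ 2 ℕ.* j) ≡ even a
  even-+2* a zero    = cong even (ℕ.+-identityʳ a)
  even-+2* a (suc j) = begin
    even (a ℕ.+ 2 ℕ.* suc j)               ≡⟨ cong even (two-more a j) ⟩
    even (suc (suc (a ℕ.+ 2 ℕ.* j)))       ≡⟨ not-involutive (even (a ℕ.+ 2 ℕ.* j)) ⟩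
    even (a ℕ.+ 2 ℕ.* j)                   ≡⟨ even-+2* a j ⟩
    even a                                 ∎
    where
    open ≡-Reasoning
    two-more : ∀ a j → a ℕ.+ 2 ℕ.* suc j ≡ suc (suc (a ℕ.+ 2 ℕ.* j))
    two-more = ℕ-Solver.solve-∀

  even-%2m : ∀ a → even (a % (2 ℕ.* m)) ≡ even a
  even-%2m a = sym (begin
    even a                                                 ≡⟨ cong even (m≡m%n+[m/n]*n a (2 ℕ.* m)) ⟩
    even (a % (2 ℕ.* m) ℕ.+ a ℕ./ (2 ℕ.* m) ℕ.* (2 ℕ.* m)) ≡⟨ cong (λ z → even (a % (2 ℕ.* m) ℕ.+ z)) (regroup (a ℕ./ (2 ℕ.* m)) m) ⟩
    even (a % (2 ℕ.* m) ℕ.+ 2 ℕ.* (a ℕ./ (2 ℕ.* m) ℕ.* m)) ≡⟨ even-+2* (a % (2 ℕ.* m)) (a ℕ./ (2 ℕ.* m) ℕ.* m) ⟩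
    even (a % (2 ℕ.* m))                                   ∎)
    where
    open ≡-Reasoning
    regroup : ∀ q n → q ℕ.* (2 ℕ.* n) ≡ 2 ℕ.* (q ℕ.* n)
    regroup = ℕ-Solver.solve-∀

  -- c ≡ −1 (mod m), so antidiag (x , y) is x − y mod m.
  antidiag diag : V m → Fin m
  antidiag (x , y) = (toℕ x ℕ.+ c ℕ.* toℕ y) mod m
  diag     (x , y) = (toℕ x ℕ.+ toℕ y) mod m

  sign : Bool → ℤ
  sign true  = + 1
  sign false = - + 1

  sign-not : ∀ b → sign (not b) ≡ - sign b
  sign-not true  = refl
  sign-not false = refl

  labeling : (Fin m → ℤ) → (Fin m → ℤ) → V m → ℤ
  labeling G H v@(_ , y) = sign (even (toℕ y)) * (G (antidiag v) + H (diag v))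

  -- Fin (2 * m) reduces to Fin (suc (c + 1 * m)), so prev on it adds c + 1 * m = 2m − 1.
  module NeighbourCoordinates (a : Fin m) (b : Fin (2 ℕ.* m)) where
    private
      X = toℕ a
      Y = toℕ b

    even-next : even (toℕ (next b)) ≡ not (even Y)
    even-next = trans (cong even (toℕ-next b)) (even-%2m (suc Y))

    even-prev : even (toℕ (prev b)) ≡ not (even Y)
    even-prev = begin
      even (toℕ (prev b))                    ≡⟨ cong even (toℕ-prev b) ⟩
      even ((Y ℕ.+ (c ℕ.+ 1 ℕ.* m)) % (2 ℕ.* m)) ≡⟨ even-%2m (Y ℕ.+ (c ℕ.+ 1 ℕ.* m)) ⟩
      even (Y ℕ.+ (c ℕ.+ 1 ℕ.* m))           ≡⟨ cong even (odd-shift Y c) ⟩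
      not (even (Y ℕ.+ 2 ℕ.* c))             ≡⟨ cong not (even-+2* Y c) ⟩
      not (even Y)                           ∎
      where
      open ≡-Reasoning
      odd-shift : ∀ Y c → Y ℕ.+ (c ℕ.+ 1 ℕ.* suc c) ≡ suc (Y ℕ.+ 2 ℕ.* c)
      odd-shift = ℕ-Solver.solve-∀

    private
      next-a≈ : toℕ (next a) ≈ suc X
      next-a≈ = trans (cong (_% m) (toℕ-next a)) (%≈ (suc X))
      prev-a≈ : toℕ (prev a) ≈ X ℕ.+ c
      prev-a≈ = trans (cong (_% m) (toℕ-prev a)) (%≈ (X ℕ.+ c))
      next-b≈ : toℕ (next b) ≈ suc Y
      next-b≈ = trans (cong (_% m) (toℕ-next b)) (%2m≈ (suc Y))
      prev-b≈ : toℕ (prev b) ≈ Y ℕ.+ (c ℕ.+ 1 ℕ.* m)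
      prev-b≈ = trans (cong (_% m) (toℕ-prev b)) (%2m≈ (Y ℕ.+ (c ℕ.+ 1 ℕ.* m)))

    antidiag-next-a : antidiag (next a , b) ≡ next (antidiag (a , b))
    antidiag-next-a = ≈⇒≡next (toℕ (next a) ℕ.+ c ℕ.* Y) (X ℕ.+ c ℕ.* Y) (≈-+ʳ (c ℕ.* Y) (toℕ (next a)) (suc X) next-a≈)

    diag-next-a : diag (next a , b) ≡ next (diag (a , b))
    diag-next-a = ≈⇒≡next (toℕ (next a) ℕ.+ Y) (X ℕ.+ Y) (≈-+ʳ Y (toℕ (next a)) (suc X) next-a≈)

    antidiag-prev-a : antidiag (prev a , b) ≡ prev (antidiag (a , b))
    antidiag-prev-a = ≈⇒≡prev (toℕ (prev a) ℕ.+ c ℕ.* Y) (X ℕ.+ c ℕ.* Y)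
      (trans (≈-+ʳ (c ℕ.* Y) (toℕ (prev a)) (X ℕ.+ c) prev-a≈) (cong (_% m) (xy∙z≈xz∙y X c (c ℕ.* Y))))

    diag-prev-a : diag (prev a , b) ≡ prev (diag (a , b))
    diag-prev-a = ≈⇒≡prev (toℕ (prev a) ℕ.+ Y) (X ℕ.+ Y) (trans (≈-+ʳ Y (toℕ (prev a)) (X ℕ.+ c) prev-a≈) (cong (_% m) (xy∙z≈xz∙y X c Y)))

    antidiag-next-b : antidiag (a , next b) ≡ prev (antidiag (a , b))
    antidiag-next-b = ≈⇒≡prev (X ℕ.+ c ℕ.* toℕ (next b)) (X ℕ.+ c ℕ.* Y)
      (trans (≈-+ˡ X (c ℕ.* toℕ (next b)) (c ℕ.* suc Y) (≈-*ˡ c (toℕ (next b)) (suc Y) next-b≈)) (cong (_% m) (regroup X Y c)))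
      where
      regroup : ∀ X Y c → X ℕ.+ c ℕ.* suc Y ≡ X ℕ.+ c ℕ.* Y ℕ.+ c
      regroup = ℕ-Solver.solve-∀

    diag-next-b : diag (a , next b) ≡ next (diag (a , b))
    diag-next-b = ≈⇒≡next (X ℕ.+ toℕ (next b)) (X ℕ.+ Y) (trans (≈-+ˡ X (toℕ (next b)) (suc Y) next-b≈) (cong (_% m) (ℕ.+-suc X Y)))

    antidiag-prev-b : antidiag (a , prev b) ≡ next (antidiag (a , b))
    antidiag-prev-b = ≈⇒≡next (X ℕ.+ c ℕ.* toℕ (prev b)) (X ℕ.+ c ℕ.* Y) (begin
      (X ℕ.+ c ℕ.* toℕ (prev b)) % m                         ≡⟨ ≈-+ˡ X (c ℕ.* toℕ (prev b)) (c ℕ.* (Y ℕ.+ (c ℕ.+ 1 ℕ.* m))) (≈-*ˡ c (toℕ (prev b)) (Y ℕ.+ (c ℕ.+ 1 ℕ.* m)) prev-b≈) ⟩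
      (X ℕ.+ c ℕ.* (Y ℕ.+ (c ℕ.+ 1 ℕ.* m))) % m              ≡⟨ +n≈ (X ℕ.+ c ℕ.* (Y ℕ.+ (c ℕ.+ 1 ℕ.* m))) ⟨
      (X ℕ.+ c ℕ.* (Y ℕ.+ (c ℕ.+ 1 ℕ.* m)) ℕ.+ m) % m        ≡⟨ cong (_% m) (regroup X Y c) ⟩
      (suc (X ℕ.+ c ℕ.* Y) ℕ.+ (c ℕ.+ c) ℕ.* m) % m          ≡⟨ [m+kn]%n≡m%n (suc (X ℕ.+ c ℕ.* Y)) (c ℕ.+ c) m ⟩
      suc (X ℕ.+ c ℕ.* Y) % m                                ∎)
      where
      open ≡-Reasoning
      regroup : ∀ X Y c → X ℕ.+ c ℕ.* (Y ℕ.+ (c ℕ.+ 1 ℕ.* suc c)) ℕ.+ suc c ≡ suc (X ℕ.+ c ℕ.* Y) ℕ.+ (c ℕ.+ c) ℕ.* suc c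
      regroup = ℕ-Solver.solve-∀

    diag-prev-b : diag (a , prev b) ≡ prev (diag (a , b))
    diag-prev-b = ≈⇒≡prev (X ℕ.+ toℕ (prev b)) (X ℕ.+ Y) (begin
      (X ℕ.+ toℕ (prev b)) % m                 ≡⟨ ≈-+ˡ X (toℕ (prev b)) (Y ℕ.+ (c ℕ.+ 1 ℕ.* m)) prev-b≈ ⟩
      (X ℕ.+ (Y ℕ.+ (c ℕ.+ 1 ℕ.* m))) % m      ≡⟨ cong (_% m) (regroup X Y c) ⟩
      (X ℕ.+ Y ℕ.+ c ℕ.+ 1 ℕ.* m) % m          ≡⟨ [m+kn]%n≡m%n (X ℕ.+ Y ℕ.+ c) 1 m ⟩
      (X ℕ.+ Y ℕ.+ c) % m                      ∎)
      where
      open ≡-Reasoning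
      regroup : ∀ X Y c → X ℕ.+ (Y ℕ.+ (c ℕ.+ 1 ℕ.* suc c)) ≡ X ℕ.+ Y ℕ.+ c ℕ.+ 1 ℕ.* suc c
      regroup = ℕ-Solver.solve-∀

  2≤c : 2 ≤ c
  2≤c = ℕ.*-monoʳ-≤ 2 1≤r

  labeling-magic : ∀ G H v → neighbourSum m (labeling G H) v ≡ + 0
  labeling-magic G H (a , b) = begin
    neighbourSum m ℓ (a , b)
      ≡⟨ neighbourSum-torus c 2≤c ℓ a b ⟩
    (ℓ (a , next b) + ℓ (a , prev b)) + (ℓ (next a , b) + ℓ (prev a , b))
      ≡⟨ cong₂ _+_ (cong₂ _+_ (flipped (next b) even-next antidiag-next-b diag-next-b) (flipped (prev b) even-prev antidiag-prev-b diag-prev-b))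
                   (cong₂ _+_ (kept (next a) antidiag-next-a diag-next-a) (kept (prev a) antidiag-prev-a diag-prev-a)) ⟩
    ((- s) * (G S⁻ + H T⁺) + (- s) * (G S⁺ + H T⁻)) + (s * (G S⁺ + H T⁺) + s * (G S⁻ + H T⁻))
      ≡⟨ cancel s (G S⁻) (G S⁺) (H T⁻) (H T⁺) ⟩
    + 0 ∎
    where
    open ≡-Reasoning
    open NeighbourCoordinates a b
    ℓ = labeling G H
    s = sign (even (toℕ b))
    S⁺ = next (antidiag (a , b))
    S⁻ = prev (antidiag (a , b))
    T⁺ = next (diag (a , b))
    T⁻ = prev (diag (a , b))
    flipped : ∀ b' {S' T'} → even (toℕ b') ≡ not (even (toℕ b)) → antidiag (a , b') ≡ S' → diag (a , b') ≡ T' →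
              ℓ (a , b') ≡ (- s) * (G S' + H T')
    flipped b' e refl refl = cong (_* _) (trans (cong sign e) (sign-not (even (toℕ b))))
    kept : ∀ a' {S' T'} → antidiag (a' , b) ≡ S' → diag (a' , b) ≡ T' → ℓ (a' , b) ≡ s * (G S' + H T')
    kept a' refl refl = refl
    cancel : ∀ s g⁻ g⁺ h⁻ h⁺ → ((- s) * (g⁻ + h⁺) + (- s) * (g⁺ + h⁻)) + (s * (g⁺ + h⁺) + s * (g⁻ + h⁻)) ≡ + 0
    cancel = solve-∀

  even-+m : ∀ a → even (a ℕ.+ m) ≡ not (even a)
  even-+m a = trans (cong even (ℕ.+-suc a c)) (cong not (even-+2* a r))

  even-2* : ∀ x → even (2 ℕ.* x) ≡ true
  even-2* x = even-+2* 0 x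

  module _ {a} (a<2m : a < 2 ℕ.* m) where
    private
      a≡ : a ≡ a % m ℕ.+ (a ℕ./ m) ℕ.* m
      a≡ = m≡m%n+[m/n]*n a m

    below-2m : a ≡ a % m ⊎ a ≡ a % m ℕ.+ m
    below-2m with a ℕ./ m | m<n*o⇒m/o<n {a} {2} {m} a<2m | a≡
    ... | 0 | _ | eq = inj₁ (trans eq (ℕ.+-identityʳ (a % m)))
    ... | 1 | _ | eq = inj₂ (trans eq (cong (a % m ℕ.+_) (ℕ.+-identityʳ m)))
    ... | suc (suc _) | s≤s (s≤s ()) | _

  ≈∧even⇒≡ : ∀ a b → a ≈ b → a < 2 ℕ.* m → b < 2 ℕ.* m → even a ≡ even b → a ≡ b
  ≈∧even⇒≡ a b a≈b a<2m b<2m ea≡eb with below-2m a<2m | below-2m b<2m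
  ... | inj₁ a≡ | inj₁ b≡ = trans a≡ (trans a≈b (sym b≡))
  ... | inj₂ a≡ | inj₂ b≡ = trans a≡ (trans (cong (ℕ._+ m) a≈b) (sym b≡))
  ... | inj₁ a≡ | inj₂ b≡ = ⊥-elim (not-¬ refl (trans ea≡eb (begin
    even b                  ≡⟨ cong even b≡ ⟩
    even (b % m ℕ.+ m)      ≡⟨ even-+m (b % m) ⟩
    not (even (b % m))      ≡⟨ cong (not ∘ even) (trans a≡ a≈b) ⟨
    not (even a)            ∎)))
    where open ≡-Reasoning
  ... | inj₂ a≡ | inj₁ b≡ = ⊥-elim (not-¬ ea≡eb (begin
    even a                  ≡⟨ cong even a≡ ⟩
    even (a % m ℕ.+ m)      ≡⟨ even-+m (a % m) ⟩
    not (even (a % m))      ≡⟨ cong (not ∘ even) (trans b≡ (sym a≈b)) ⟨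
    not (even b)            ∎))
    where open ≡-Reasoning

  ≈-cancelˡ : ∀ X Y Y' → X < m → X ℕ.+ Y ≈ X ℕ.+ Y' → Y ≈ Y'
  ≈-cancelˡ X Y Y' X<m X+Y≈X+Y' = trans (sym (complement Y)) (trans (≈-+ˡ (m ℕ.∸ X) _ _ X+Y≈X+Y') (complement Y'))
    where
    complement : ∀ Z → (m ℕ.∸ X ℕ.+ (X ℕ.+ Z)) % m ≡ Z % m
    complement Z = begin
      (m ℕ.∸ X ℕ.+ (X ℕ.+ Z)) % m  ≡⟨ cong (_% m) (ℕ.+-assoc (m ℕ.∸ X) X Z) ⟨
      (m ℕ.∸ X ℕ.+ X ℕ.+ Z) % m    ≡⟨ cong (λ w → (w ℕ.+ Z) % m) (ℕ.m∸n+n≡m (ℕ.<⇒≤ X<m)) ⟩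
      (m ℕ.+ Z) % m                ≡⟨ cong (_% m) (ℕ.+-comm m Z) ⟩
      (Z ℕ.+ m) % m                ≡⟨ +n≈ Z ⟩
      Z % m                        ∎
      where open ≡-Reasoning

  coordinates-injective : ∀ v v' → antidiag v ≡ antidiag v' → diag v ≡ diag v' →
                          even (toℕ (proj₂ v)) ≡ even (toℕ (proj₂ v')) → v ≡ v'
  coordinates-injective (x , y) (x' , y') same-antidiag same-diag same-parity = cong₂ _,_ x≡x' y≡y'
    where
    X = toℕ x
    X' = toℕ x'
    Y = toℕ y
    Y' = toℕ y'
    mod-≡ : ∀ u u' → u mod m ≡ u' mod m → u ≈ u'
    mod-≡ u u' eq = trans (sym (toℕ-mod u)) (trans (cong toℕ eq) (toℕ-mod u'))
    S≈S' : X ℕ.+ c ℕ.* Y ≈ X' ℕ.+ c ℕ.* Y'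
    S≈S' = mod-≡ (X ℕ.+ c ℕ.* Y) (X' ℕ.+ c ℕ.* Y') same-antidiag
    T≈T' : X ℕ.+ Y ≈ X' ℕ.+ Y'
    T≈T' = mod-≡ (X ℕ.+ Y) (X' ℕ.+ Y') same-diag
    sum≡ : ∀ X Y c → (X ℕ.+ c ℕ.* Y) ℕ.+ (X ℕ.+ Y) ≡ 2 ℕ.* X ℕ.+ Y ℕ.* suc c
    sum≡ = ℕ-Solver.solve-∀
    2X≈2X' : 2 ℕ.* X ≈ 2 ℕ.* X'
    2X≈2X' = begin
      (2 ℕ.* X) % m                                    ≡⟨ [m+kn]%n≡m%n (2 ℕ.* X) Y m ⟨
      (2 ℕ.* X ℕ.+ Y ℕ.* m) % m                        ≡⟨ cong (_% m) (sum≡ X Y c) ⟨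
      ((X ℕ.+ c ℕ.* Y) ℕ.+ (X ℕ.+ Y)) % m              ≡⟨ ≈-+ʳ (X ℕ.+ Y) (X ℕ.+ c ℕ.* Y) (X' ℕ.+ c ℕ.* Y') S≈S' ⟩
      ((X' ℕ.+ c ℕ.* Y') ℕ.+ (X ℕ.+ Y)) % m            ≡⟨ ≈-+ˡ (X' ℕ.+ c ℕ.* Y') (X ℕ.+ Y) (X' ℕ.+ Y') T≈T' ⟩
      ((X' ℕ.+ c ℕ.* Y') ℕ.+ (X' ℕ.+ Y')) % m          ≡⟨ cong (_% m) (sum≡ X' Y' c) ⟩
      (2 ℕ.* X' ℕ.+ Y' ℕ.* m) % m                      ≡⟨ [m+kn]%n≡m%n (2 ℕ.* X') Y' m ⟩
      (2 ℕ.* X') % m                                   ∎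
      where open ≡-Reasoning
    X≡X' : X ≡ X'
    X≡X' = ℕ.*-cancelˡ-≡ X X' 2 (≈∧even⇒≡ (2 ℕ.* X) (2 ℕ.* X') 2X≈2X'
      (ℕ.*-monoʳ-< 2 (toℕ<n x)) (ℕ.*-monoʳ-< 2 (toℕ<n x')) (trans (even-2* X) (sym (even-2* X'))))
    x≡x' : x ≡ x'
    x≡x' = toℕ-injective X≡X'
    y≡y' : y ≡ y'
    y≡y' = toℕ-injective (≈∧even⇒≡ Y Y'
      (≈-cancelˡ X Y Y' (toℕ<n x) (trans T≈T' (cong (λ z → (z ℕ.+ Y') % m) (sym X≡X'))))
      (toℕ<n y) (toℕ<n y') same-parity)

  -- Rows 0 and 1 give δ a = ε a and δ (prev a) = ε (next a) for δ = G − G' and ε = H' − H,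
  -- so δ is invariant under a ↦ a + 2, hence constant because m is odd.
  module _ (G H G' H' : Fin m → ℤ) (same : ∀ v → labeling G H v ≡ labeling G' H' v) where

    private
      row₀ row₁ : Fin (2 ℕ.* m)
      row₀ = zero
      row₁ = fromℕ< {1} (ℕ.*-monoʳ-≤ 2 (s≤s z≤n))

      toℕ-row₁ : toℕ row₁ ≡ 1
      toℕ-row₁ = toℕ-fromℕ< (ℕ.*-monoʳ-≤ 2 (s≤s z≤n))

      labeling-row₀ : ∀ G H a → labeling G H (a , row₀) ≡ G a + H a
      labeling-row₀ G H a = trans (ℤ.*-identityˡ _) (cong₂ (λ i j → G i + H j) antidiag≡ diag≡)
        where
        antidiag≡ : antidiag (a , row₀) ≡ a
        antidiag≡ = trans (cong (_mod m) (trans (cong (toℕ a ℕ.+_) (ℕ.*-zeroʳ c)) (ℕ.+-identityʳ (toℕ a)))) (mod-toℕ a)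
        diag≡ : diag (a , row₀) ≡ a
        diag≡ = trans (cong (_mod m) (ℕ.+-identityʳ (toℕ a))) (mod-toℕ a)

      labeling-row₁ : ∀ G H a → labeling G H (a , row₁) ≡ - (G (prev a) + H (next a))
      labeling-row₁ G H a = begin
        sign (even (toℕ row₁)) * (G (antidiag (a , row₁)) + H (diag (a , row₁)))
          ≡⟨ cong₂ (λ y y' → sign (even y) * (G ((toℕ a ℕ.+ c ℕ.* y') mod m) + H ((toℕ a ℕ.+ y') mod m))) toℕ-row₁ toℕ-row₁ ⟩
        - + 1 * (G ((toℕ a ℕ.+ c ℕ.* 1) mod m) + H ((toℕ a ℕ.+ 1) mod m))
          ≡⟨ cong₂ (λ i j → - + 1 * (G i + H j)) (cong (λ z → (toℕ a ℕ.+ z) mod m) (ℕ.*-identityʳ c)) (cong (_mod m) (ℕ.+-comm (toℕ a) 1)) ⟩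
        - + 1 * (G (prev a) + H (next a))
          ≡⟨ ℤ.-1*i≡-i _ ⟩
        - (G (prev a) + H (next a)) ∎
        where open ≡-Reasoning

      transfer : ∀ g h g' h' → g + h ≡ g' + h' → g - g' ≡ h' - h
      transfer g h g' h' eq = begin
        g - g'                  ≡⟨ cancel g g' h ⟩
        (g + h) - (g' + h)      ≡⟨ cong (_- (g' + h)) eq ⟩
        (g' + h') - (g' + h)    ≡⟨ cancel' g' h' h ⟩
        h' - h                  ∎
        where
        open ≡-Reasoning
        cancel : ∀ g g' h → g - g' ≡ (g + h) - (g' + h)
        cancel = solve-∀
        cancel' : ∀ g' h' h → (g' + h') - (g' + h) ≡ h' - h
        cancel' = solve-∀

      δ ε : Fin m → ℤ
      δ i = G i - G' i
      ε i = H' i - H i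

      δ≡ε : ∀ a → δ a ≡ ε a
      δ≡ε a = transfer (G a) (H a) (G' a) (H' a) (trans (sym (labeling-row₀ G H a)) (trans (same (a , row₀)) (labeling-row₀ G' H' a)))

      δ∘prev≡ε∘next : ∀ a → δ (prev a) ≡ ε (next a)
      δ∘prev≡ε∘next a = transfer (G (prev a)) (H (next a)) (G' (prev a)) (H' (next a)) (ℤ.neg-injective (trans (sym (labeling-row₁ G H a)) (trans (same (a , row₁)) (labeling-row₁ G' H' a))))

      Δ : ℕ → ℤ
      Δ n = δ (n mod m)

      Δ-+m : ∀ n → Δ (n ℕ.+ m) ≡ Δ n
      Δ-+m n = cong δ (mod-cong (n ℕ.+ m) n (+n≈ n))

      Δ-+2 : ∀ n → Δ (n ℕ.+ 2) ≡ Δ n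
      Δ-+2 n = begin
        δ ((n ℕ.+ 2) mod m)             ≡⟨ cong (λ z → δ (z mod m)) (ℕ.+-comm n 2) ⟩
        δ (suc (suc n) mod m)           ≡⟨ cong δ (next-mod (suc n)) ⟨
        δ (next (suc n mod m))          ≡⟨ δ≡ε (next (suc n mod m)) ⟩
        ε (next (suc n mod m))          ≡⟨ δ∘prev≡ε∘next (suc n mod m) ⟨
        δ (prev (suc n mod m))          ≡⟨ cong δ (prev-mod (suc n)) ⟩
        δ ((suc n ℕ.+ c) mod m)         ≡⟨ cong (λ z → δ (z mod m)) (ℕ.+-suc n c) ⟨
        Δ (n ℕ.+ m)                     ≡⟨ Δ-+m n ⟩
        Δ n                             ∎
        where open ≡-Reasoning

      Δ-+2* : ∀ n j → Δ (n ℕ.+ 2 ℕ.* j) ≡ Δ n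
      Δ-+2* n zero    = cong Δ (ℕ.+-identityʳ n)
      Δ-+2* n (suc j) = trans (cong Δ (two-more n j)) (trans (Δ-+2 (n ℕ.+ 2 ℕ.* j)) (Δ-+2* n j))
        where
        two-more : ∀ n j → n ℕ.+ 2 ℕ.* suc j ≡ n ℕ.+ 2 ℕ.* j ℕ.+ 2
        two-more = ℕ-Solver.solve-∀

      Δ-suc : ∀ n → Δ (suc n) ≡ Δ n
      Δ-suc n = trans (sym (Δ-+m (suc n))) (trans (cong Δ (odd-period n r)) (Δ-+2* n (suc r)))
        where
        odd-period : ∀ n r → suc n ℕ.+ suc (2 ℕ.* r) ≡ n ℕ.+ 2 ℕ.* suc r
        odd-period = ℕ-Solver.solve-∀

      Δ-constant : ∀ n → Δ n ≡ Δ 0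
      Δ-constant zero    = refl
      Δ-constant (suc n) = trans (Δ-suc n) (Δ-constant n)

      δ-constant : ∀ i → δ i ≡ Δ 0
      δ-constant i = trans (cong δ (sym (mod-toℕ i))) (Δ-constant (toℕ i))

      add-back : ∀ {x y d} → x - y ≡ d → x ≡ y + d
      add-back {x} {y} x-y≡d = trans (restore x y) (cong (λ z → y + z) x-y≡d)
        where
        restore : ∀ x y → x ≡ y + (x - y)
        restore = solve-∀

    labeling-shift : ∃[ d ] (∀ i → G i ≡ G' i + d) × (∀ i → H' i ≡ H i + d)
    labeling-shift = Δ 0 , (λ i → add-back (δ-constant i)) , (λ i → add-back (trans (sym (δ≡ε i)) (δ-constant i)))

module Tilings (r : ℕ) (1≤r : 1 ≤ r) where
  open import Data.Nat as ℕ using (ℕ; suc; _≤_; _<_; _%_; s≤s; z≤n)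
  open import Defs using (InLabelSet; order)
  open LabelSet
  open Labeling r 1≤r using (c; m; 2≤c; sign)
  import Data.Nat.Properties as ℕ
  open import Algebra.Properties.CommutativeSemigroup ℕ.+-commutativeSemigroup using (xy∙z≈xz∙y)
  open import Data.Nat.DivMod using (m<n⇒m%n≡m; [m+kn]%n≡m%n)
  import Data.Nat.Tactic.RingSolver as ℕ-Solver
  open import Data.Integer as ℤ using (ℤ; +_; _⊖_; _+_; _*_; -_)
  import Data.Integer.Properties as ℤ
  open import Data.Bool using (Bool; true; false; not; _xor_)
  open import Data.List using (_∷_; [])
  open import Data.Product using (_×_; _,_; proj₁; proj₂; ∃-syntax)
  open import Data.Empty using (⊥-elim)
  open import Relation.Binary.PropositionalEquality

  N : ℕ
  N = order m

  digits-unique : ∀ B a a' x x' → a < B → a' < B → a ℕ.+ B ℕ.* x ≡ a' ℕ.+ B ℕ.* x' → a ≡ a' × x ≡ x'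
  digits-unique B@(suc _) a a' x x' a<B a'<B eq =
    a≡a' , ℕ.*-cancelˡ-≡ x x' B (ℕ.+-cancelˡ-≡ a _ _ (trans eq (cong (ℕ._+ B ℕ.* x') (sym a≡a'))))
    where
    low-digit : ∀ {d} y → d < B → (d ℕ.+ B ℕ.* y) % B ≡ d
    low-digit {d} y d<B = trans (cong (λ z → (d ℕ.+ z) % B) (ℕ.*-comm B y)) (trans ([m+kn]%n≡m%n d y B) (m<n⇒m%n≡m d<B))
    a≡a' : a ≡ a'
    a≡a' = trans (sym (low-digit x a<B)) (trans (cong (_% B) eq) (low-digit x' a'<B))

  -- The values ±(α k ⊖ β) + step · (j ⊖ r) for k, j < m and both signs are the elements of 𝒩_N, each once.
  record Tiling : Set where
    field
      α    : ℕ → ℕ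
      β    : ℕ
      step : ℕ
      step-even : ∃[ h ] step ≡ 2 ℕ.* h
      α+β-odd   : ∀ k → ∃[ w ] α k ℕ.+ β ≡ suc (2 ℕ.* w)
      upper : ∀ k → k ≤ c → α k ℕ.+ step ℕ.* r < β ℕ.+ N
      lower : ∀ k → k ≤ c → β ℕ.+ step ℕ.* r < α k ℕ.+ N
      same-sign-unique : ∀ k k' j j' → k < m → k' < m → j < m → j' < m →
                         α k ℕ.+ step ℕ.* j ≡ α k' ℕ.+ step ℕ.* j' → k ≡ k' × j ≡ j'
      opposite-sign-distinct : ∀ k k' j j' → k < m → k' < m → j < m → j' < m →
                               α k ℕ.+ α k' ℕ.+ step ℕ.* j ≢ β ℕ.+ β ℕ.+ step ℕ.* j'

  <m⇒≤c : ∀ {k} → k < m → k ≤ c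
  <m⇒≤c (s≤s k≤c) = k≤c

  0<m : 0 < m
  0<m = s≤s z≤n

  1<m : 1 < m
  1<m = s≤s (ℕ.≤-trans (s≤s z≤n) 2≤c)

  m≤2m : m ≤ 2 ℕ.* m
  m≤2m = ℕ.m≤m+n m (m ℕ.+ 0)

  +-suc-≡⇒< : ∀ {a b n} → a ℕ.+ suc b ≡ n → a < n
  +-suc-≡⇒< {a} eq = subst (a <_) eq (ℕ.m<m+n a (s≤s z≤n))

  data Shape : Set where
    odds oddMultiples nearMultiples nearSquare : Shape

  module _ where
    open Tiling

    tiling : Shape → Tiling

    -- ±(2k+1) + 4m·[−r, r]
    tiling odds .α k = suc (2 ℕ.* k)
    tiling odds .β = 0
    tiling odds .step = 4 ℕ.* m
    tiling odds .step-even = 2 ℕ.* m , ℕ.*-assoc 2 2 m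
    tiling odds .α+β-odd k = k , ℕ.+-identityʳ _
    tiling odds .upper k k≤c = ℕ.≤-trans (s≤s (ℕ.+-monoˡ-≤ (4 ℕ.* m ℕ.* r) (s≤s (ℕ.*-monoʳ-≤ 2 k≤c)))) (ℕ.≤-reflexive (N≡ r))
      where
      N≡ : ∀ r → suc (suc (2 ℕ.* (2 ℕ.* r)) ℕ.+ 4 ℕ.* suc (2 ℕ.* r) ℕ.* r) ≡ 0 ℕ.+ suc (2 ℕ.* r) ℕ.* (2 ℕ.* suc (2 ℕ.* r))
      N≡ = ℕ-Solver.solve-∀
    tiling odds .lower k k≤c = ℕ.≤-trans (+-suc-≡⇒< (N≡ r)) (ℕ.m≤n+m N (suc (2 ℕ.* k)))
      where
      N≡ : ∀ r → 0 ℕ.+ 4 ℕ.* suc (2 ℕ.* r) ℕ.* r ℕ.+ suc (4 ℕ.* r ℕ.+ 1) ≡ suc (2 ℕ.* r) ℕ.* (2 ℕ.* suc (2 ℕ.* r))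
      N≡ = ℕ-Solver.solve-∀
    tiling odds .same-sign-unique k k' j j' k<m k'<m _ _ eq =
      digits-unique (2 ℕ.* m) k k' j j' (ℕ.<-≤-trans k<m m≤2m) (ℕ.<-≤-trans k'<m m≤2m)
        (ℕ.*-cancelˡ-≡ _ _ 2 (trans (sym (halve k j m)) (trans (ℕ.suc-injective eq) (halve k' j' m))))
      where
      halve : ∀ k j m → 2 ℕ.* k ℕ.+ 4 ℕ.* m ℕ.* j ≡ 2 ℕ.* (k ℕ.+ 2 ℕ.* m ℕ.* j)
      halve = ℕ-Solver.solve-∀
    tiling odds .opposite-sign-distinct k k' j j' k<m k'<m _ _ eq =
      ℕ.1+n≢0 (proj₁ (digits-unique (2 ℕ.* m) (suc (k ℕ.+ k')) 0 j j' k+k'<2m (ℕ.<-≤-trans 0<m m≤2m)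
        (ℕ.*-cancelˡ-≡ _ _ 2 (trans (sym (halveˡ k k' j m)) (trans eq (halveʳ j' m))))))
      where
      halveˡ : ∀ k k' j m → suc (2 ℕ.* k) ℕ.+ suc (2 ℕ.* k') ℕ.+ 4 ℕ.* m ℕ.* j ≡ 2 ℕ.* (suc (k ℕ.+ k') ℕ.+ 2 ℕ.* m ℕ.* j)
      halveˡ = ℕ-Solver.solve-∀
      halveʳ : ∀ j m → 0 ℕ.+ 0 ℕ.+ 4 ℕ.* m ℕ.* j ≡ 2 ℕ.* (0 ℕ.+ 2 ℕ.* m ℕ.* j)
      halveʳ = ℕ-Solver.solve-∀
      double-suc : ∀ c → suc (suc (c ℕ.+ c)) ≡ 2 ℕ.* suc c
      double-suc = ℕ-Solver.solve-∀
      k+k'<2m : suc (k ℕ.+ k') < 2 ℕ.* m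
      k+k'<2m = ℕ.≤-trans (s≤s (s≤s (ℕ.+-mono-≤ (<m⇒≤c k<m) (<m⇒≤c k'<m)))) (ℕ.≤-reflexive (double-suc c))

    -- ±m(2k+1) + 2·[−r, r]
    tiling oddMultiples .α k = m ℕ.* suc (2 ℕ.* k)
    tiling oddMultiples .β = 0
    tiling oddMultiples .step = 2
    tiling oddMultiples .step-even = 1 , refl
    tiling oddMultiples .α+β-odd k = k ℕ.+ r ℕ.* suc (2 ℕ.* k) , odd≡ r k
      where
      odd≡ : ∀ r k → suc (2 ℕ.* r) ℕ.* suc (2 ℕ.* k) ℕ.+ 0 ≡ suc (2 ℕ.* (k ℕ.+ r ℕ.* suc (2 ℕ.* k)))
      odd≡ = ℕ-Solver.solve-∀
    tiling oddMultiples .upper k k≤c = ℕ.≤-trans (s≤s (ℕ.+-monoˡ-≤ (2 ℕ.* r) (ℕ.*-monoʳ-≤ m (s≤s (ℕ.*-monoʳ-≤ 2 k≤c))))) (ℕ.≤-reflexive (N≡ r))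
      where
      N≡ : ∀ r → suc (suc (2 ℕ.* r) ℕ.* suc (2 ℕ.* (2 ℕ.* r)) ℕ.+ 2 ℕ.* r) ≡ 0 ℕ.+ suc (2 ℕ.* r) ℕ.* (2 ℕ.* suc (2 ℕ.* r))
      N≡ = ℕ-Solver.solve-∀
    tiling oddMultiples .lower k k≤c = ℕ.≤-trans (+-suc-≡⇒< (N≡ r)) (ℕ.m≤n+m N (m ℕ.* suc (2 ℕ.* k)))
      where
      N≡ : ∀ r → 0 ℕ.+ 2 ℕ.* r ℕ.+ suc (8 ℕ.* r ℕ.* r ℕ.+ 6 ℕ.* r ℕ.+ 1) ≡ suc (2 ℕ.* r) ℕ.* (2 ℕ.* suc (2 ℕ.* r))
      N≡ = ℕ-Solver.solve-∀
    tiling oddMultiples .same-sign-unique k k' j j' _ _ j<m j'<m eq =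
      let j≡j' , k≡k' = digits-unique m j j' k k' j<m j'<m
                          (ℕ.*-cancelˡ-≡ _ _ 2 (ℕ.+-cancelˡ-≡ m _ _ (trans (sym (halve m k j)) (trans eq (halve m k' j')))))
      in k≡k' , j≡j'
      where
      halve : ∀ m k j → m ℕ.* suc (2 ℕ.* k) ℕ.+ 2 ℕ.* j ≡ m ℕ.+ 2 ℕ.* (j ℕ.+ m ℕ.* k)
      halve = ℕ-Solver.solve-∀
    tiling oddMultiples .opposite-sign-distinct k k' j j' _ _ j<m j'<m eq =
      ℕ.1+n≢0 (proj₂ (digits-unique m j j' (suc (k ℕ.+ k')) 0 j<m j'<m
        (ℕ.*-cancelˡ-≡ _ _ 2 (trans (sym (halveˡ m k k' j)) (trans eq (halveʳ m j'))))))
      where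
      halveˡ : ∀ m k k' j → m ℕ.* suc (2 ℕ.* k) ℕ.+ m ℕ.* suc (2 ℕ.* k') ℕ.+ 2 ℕ.* j ≡ 2 ℕ.* (j ℕ.+ m ℕ.* suc (k ℕ.+ k'))
      halveˡ = ℕ-Solver.solve-∀
      halveʳ : ∀ m j → 0 ℕ.+ 0 ℕ.+ 2 ℕ.* j ≡ 2 ℕ.* (j ℕ.+ m ℕ.* 0)
      halveʳ = ℕ-Solver.solve-∀

    -- ±(1 + 4m(k − r)) + 4·[−r, r]
    tiling nearMultiples .α k = suc (4 ℕ.* m ℕ.* k)
    tiling nearMultiples .β = 4 ℕ.* m ℕ.* r
    tiling nearMultiples .step = 4
    tiling nearMultiples .step-even = 2 , refl
    tiling nearMultiples .α+β-odd k = 2 ℕ.* m ℕ.* k ℕ.+ 2 ℕ.* m ℕ.* r , odd≡ m k r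
      where
      odd≡ : ∀ m k r → suc (4 ℕ.* m ℕ.* k) ℕ.+ 4 ℕ.* m ℕ.* r ≡ suc (2 ℕ.* (2 ℕ.* m ℕ.* k ℕ.+ 2 ℕ.* m ℕ.* r))
      odd≡ = ℕ-Solver.solve-∀
    tiling nearMultiples .upper k k≤c = ℕ.≤-trans (s≤s (ℕ.+-monoˡ-≤ (4 ℕ.* r) (s≤s (ℕ.*-monoʳ-≤ (4 ℕ.* m) k≤c)))) (ℕ.≤-reflexive (N≡ r))
      where
      N≡ : ∀ r → suc (suc (4 ℕ.* suc (2 ℕ.* r) ℕ.* (2 ℕ.* r)) ℕ.+ 4 ℕ.* r) ≡ 4 ℕ.* suc (2 ℕ.* r) ℕ.* r ℕ.+ suc (2 ℕ.* r) ℕ.* (2 ℕ.* suc (2 ℕ.* r))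
      N≡ = ℕ-Solver.solve-∀
    tiling nearMultiples .lower k k≤c = ℕ.≤-trans (+-suc-≡⇒< (N≡ r)) (ℕ.m≤n+m N (suc (4 ℕ.* m ℕ.* k)))
      where
      N≡ : ∀ r → 4 ℕ.* suc (2 ℕ.* r) ℕ.* r ℕ.+ 4 ℕ.* r ℕ.+ suc 1 ≡ suc (2 ℕ.* r) ℕ.* (2 ℕ.* suc (2 ℕ.* r))
      N≡ = ℕ-Solver.solve-∀
    tiling nearMultiples .same-sign-unique k k' j j' _ _ j<m j'<m eq =
      let j≡j' , k≡k' = digits-unique m j j' k k' j<m j'<m
                          (ℕ.*-cancelˡ-≡ _ _ 4 (trans (sym (quarter m k j)) (trans (ℕ.suc-injective eq) (quarter m k' j'))))
      in k≡k' , j≡j'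
      where
      quarter : ∀ m k j → 4 ℕ.* m ℕ.* k ℕ.+ 4 ℕ.* j ≡ 4 ℕ.* (j ℕ.+ m ℕ.* k)
      quarter = ℕ-Solver.solve-∀
    tiling nearMultiples .opposite-sign-distinct k k' j j' _ _ _ _ eq =
      ℕ.even≢odd (2 ℕ.* m ℕ.* r ℕ.+ j') (m ℕ.* k ℕ.+ m ℕ.* k' ℕ.+ j)
        (ℕ.*-cancelˡ-≡ _ _ 2 (trans (halveʳ m r j') (trans (sym eq) (halveˡ m k k' j))))
      where
      halveˡ : ∀ m k k' j → suc (4 ℕ.* m ℕ.* k) ℕ.+ suc (4 ℕ.* m ℕ.* k') ℕ.+ 4 ℕ.* j ≡ 2 ℕ.* suc (2 ℕ.* (m ℕ.* k ℕ.+ m ℕ.* k' ℕ.+ j))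
      halveˡ = ℕ-Solver.solve-∀
      halveʳ : ∀ m r j → 2 ℕ.* (2 ℕ.* (2 ℕ.* m ℕ.* r ℕ.+ j)) ≡ 4 ℕ.* m ℕ.* r ℕ.+ 4 ℕ.* m ℕ.* r ℕ.+ 4 ℕ.* j
      halveʳ = ℕ-Solver.solve-∀

    -- ±(m² + 2(k − r)) + 2m·[−r, r]
    tiling nearSquare .α k = suc (2 ℕ.* k ℕ.+ c ℕ.* m)
    tiling nearSquare .β = 0
    tiling nearSquare .step = 2 ℕ.* m
    tiling nearSquare .step-even = m , refl
    tiling nearSquare .α+β-odd k = k ℕ.+ r ℕ.* suc (2 ℕ.* r) , odd≡ k r
      where
      odd≡ : ∀ k r → suc (2 ℕ.* k ℕ.+ 2 ℕ.* r ℕ.* suc (2 ℕ.* r)) ℕ.+ 0 ≡ suc (2 ℕ.* (k ℕ.+ r ℕ.* suc (2 ℕ.* r)))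
      odd≡ = ℕ-Solver.solve-∀
    tiling nearSquare .upper k k≤c = ℕ.≤-trans (s≤s (ℕ.+-monoˡ-≤ (2 ℕ.* m ℕ.* r) (s≤s (ℕ.+-monoˡ-≤ (c ℕ.* m) (ℕ.*-monoʳ-≤ 2 k≤c))))) (ℕ.≤-reflexive (N≡ r))
      where
      N≡ : ∀ r → suc (suc (2 ℕ.* (2 ℕ.* r) ℕ.+ 2 ℕ.* r ℕ.* suc (2 ℕ.* r)) ℕ.+ 2 ℕ.* suc (2 ℕ.* r) ℕ.* r) ≡ 0 ℕ.+ suc (2 ℕ.* r) ℕ.* (2 ℕ.* suc (2 ℕ.* r))
      N≡ = ℕ-Solver.solve-∀
    tiling nearSquare .lower k k≤c = ℕ.≤-trans (+-suc-≡⇒< (N≡ r)) (ℕ.m≤n+m N (suc (2 ℕ.* k ℕ.+ c ℕ.* m)))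
      where
      N≡ : ∀ r → 0 ℕ.+ 2 ℕ.* suc (2 ℕ.* r) ℕ.* r ℕ.+ suc (4 ℕ.* r ℕ.* r ℕ.+ 6 ℕ.* r ℕ.+ 1) ≡ suc (2 ℕ.* r) ℕ.* (2 ℕ.* suc (2 ℕ.* r))
      N≡ = ℕ-Solver.solve-∀
    tiling nearSquare .same-sign-unique k k' j j' k<m k'<m _ _ eq =
      digits-unique m k k' j j' k<m k'<m
        (ℕ.*-cancelˡ-≡ _ _ 2 (ℕ.+-cancelˡ-≡ (suc (c ℕ.* m)) _ _ (trans (sym (halve m c k j)) (trans eq (halve m c k' j')))))
      where
      halve : ∀ m c k j → suc (2 ℕ.* k ℕ.+ c ℕ.* m) ℕ.+ 2 ℕ.* m ℕ.* j ≡ suc (c ℕ.* m) ℕ.+ 2 ℕ.* (k ℕ.+ m ℕ.* j)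
      halve = ℕ-Solver.solve-∀
    tiling nearSquare .opposite-sign-distinct k k' j j' _ _ _ j'<m eq = ℕ.<-irrefl refl (ℕ.≤-trans (ℕ.≤-reflexive halves) mj'≤X)
      where
      X = k ℕ.+ k' ℕ.+ m ℕ.* c ℕ.+ m ℕ.* j
      halveˡ : ∀ m c k k' j → suc (2 ℕ.* k ℕ.+ c ℕ.* m) ℕ.+ suc (2 ℕ.* k' ℕ.+ c ℕ.* m) ℕ.+ 2 ℕ.* m ℕ.* j ≡ 2 ℕ.* suc (k ℕ.+ k' ℕ.+ m ℕ.* c ℕ.+ m ℕ.* j)
      halveˡ = ℕ-Solver.solve-∀
      halveʳ : ∀ m j → 0 ℕ.+ 0 ℕ.+ 2 ℕ.* m ℕ.* j ≡ 2 ℕ.* (m ℕ.* j)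
      halveʳ = ℕ-Solver.solve-∀
      halves : suc X ≡ m ℕ.* j'
      halves = ℕ.*-cancelˡ-≡ _ _ 2 (trans (sym (halveˡ m c k k' j)) (trans eq (halveʳ m j')))
      mj'≤X : m ℕ.* j' ≤ X
      mj'≤X = ℕ.≤-trans (ℕ.*-monoʳ-≤ m (<m⇒≤c j'<m)) (ℕ.≤-trans (ℕ.m≤n+m (m ℕ.* c) (k ℕ.+ k')) (ℕ.m≤m+n _ (m ℕ.* j)))

  N≡m²+m² : N ≡ m ℕ.* m ℕ.+ m ℕ.* m
  N≡m²+m² = square r
    where
    square : ∀ r → suc (2 ℕ.* r) ℕ.* (2 ℕ.* suc (2 ℕ.* r)) ≡ suc (2 ℕ.* r) ℕ.* suc (2 ℕ.* r) ℕ.+ suc (2 ℕ.* r) ℕ.* suc (2 ℕ.* r)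
    square = ℕ-Solver.solve-∀

  module _ (D : Tiling) where
    open Tiling D

    hi lo : Bool → ℕ → ℕ
    hi true  k = α k
    hi false k = β
    lo true  k = β
    lo false k = α k

    base : ℕ → ℤ
    base k = α k ⊖ β

    progression : ℕ → ℤ
    progression j = (step ℕ.* j) ⊖ (step ℕ.* r)

    value : Bool → ℕ → ℕ → ℤ
    value s k j = sign s * base k + progression j

    signed-base : ∀ s k → sign s * base k ≡ hi s k ⊖ lo s k
    signed-base true  k = ℤ.*-identityˡ (base k)
    signed-base false k = trans (ℤ.-1*i≡-i (base k)) (sym (ℤ.⊖-swap β (α k)))

    value-⊖ : ∀ s k j → value s k j ≡ (hi s k ℕ.+ step ℕ.* j) ⊖ (lo s k ℕ.+ step ℕ.* r)
    value-⊖ s k j = trans (cong (_+ progression j) (signed-base s k)) (⊖-+-⊖ (hi s k) (lo s k) (step ℕ.* j) (step ℕ.* r))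

    value-injective : ∀ s s' k k' j j' → k < m → k' < m → j < m → j' < m →
                      value s k j ≡ value s' k' j' → s ≡ s' × k ≡ k' × j ≡ j'
    value-injective s s' k k' j j' k<m k'<m j<m j'<m eq =
      split s s' (⊖≡⊖⇒+≡+ (hi s k ℕ.+ step ℕ.* j) (lo s k ℕ.+ step ℕ.* r) (hi s' k' ℕ.+ step ℕ.* j') (lo s' k' ℕ.+ step ℕ.* r) (trans (sym (value-⊖ s k j)) (trans eq (value-⊖ s' k' j'))))
      where
      σ = step
      split : ∀ s s' → hi s k ℕ.+ σ ℕ.* j ℕ.+ (lo s' k' ℕ.+ σ ℕ.* r) ≡ hi s' k' ℕ.+ σ ℕ.* j' ℕ.+ (lo s k ℕ.+ σ ℕ.* r) →
              s ≡ s' × k ≡ k' × j ≡ j'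
      split true true e with same-sign-unique k k' j j' k<m k'<m j<m j'<m (ℕ.+-cancelʳ-≡ (β ℕ.+ σ ℕ.* r) _ _ e)
      ... | k≡k' , j≡j' = refl , k≡k' , j≡j'
      split false false e with same-sign-unique k' k j j' k'<m k<m j<m j'<m
                                 (ℕ.+-cancelʳ-≡ (β ℕ.+ σ ℕ.* r) _ _ (trans (sym (swap β σ j (α k') r)) (trans e (swap β σ j' (α k) r))))
        where
        swap : ∀ b σ j a r → b ℕ.+ σ ℕ.* j ℕ.+ (a ℕ.+ σ ℕ.* r) ≡ a ℕ.+ σ ℕ.* j ℕ.+ (b ℕ.+ σ ℕ.* r)
        swap = ℕ-Solver.solve-∀
      ... | k'≡k , j≡j' = refl , sym k'≡k , j≡j'
      split true false e = ⊥-elim (opposite-sign-distinct k k' j j' k<m k'<m j<m j'<m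
                             (ℕ.+-cancelʳ-≡ (σ ℕ.* r) _ _ (trans (sym (gather (α k) σ j (α k') r)) (trans e (gather β σ j' β r)))))
        where
        gather : ∀ a σ j a' r → a ℕ.+ σ ℕ.* j ℕ.+ (a' ℕ.+ σ ℕ.* r) ≡ a ℕ.+ a' ℕ.+ σ ℕ.* j ℕ.+ σ ℕ.* r
        gather = ℕ-Solver.solve-∀
      split false true e = ⊥-elim (opposite-sign-distinct k' k j' j k'<m k<m j'<m j<m
                             (ℕ.+-cancelʳ-≡ (σ ℕ.* r) _ _ (trans (sym (gather (α k') σ j' (α k) r)) (trans (sym e) (gather β σ j β r)))))
        where
        gather : ∀ a σ j a' r → a ℕ.+ σ ℕ.* j ℕ.+ (a' ℕ.+ σ ℕ.* r) ≡ a ℕ.+ a' ℕ.+ σ ℕ.* j ℕ.+ σ ℕ.* r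
        gather = ℕ-Solver.solve-∀

    value∈labels : ∀ s k j → k < m → j < m → InLabelSet N (value s k j)
    value∈labels s k j k<m j<m = subst (InLabelSet N) (sym (value-⊖ s k j))
      (⊖∈labels (m ℕ.* m) _ _ (proj₁ (α+β-odd k) ℕ.+ proj₁ step-even ℕ.* (j ℕ.+ r)) N≡m²+m² (Q<P+N s) (P<Q+N s) (P+Q≡odd s))
      where
      σ = step
      k≤c = <m⇒≤c k<m
      j≤c = <m⇒≤c j<m
      σj≤σr+σr : σ ℕ.* j ≤ σ ℕ.* r ℕ.+ σ ℕ.* r
      σj≤σr+σr = ℕ.≤-trans (ℕ.*-monoʳ-≤ σ j≤c) (ℕ.≤-reflexive (double σ r))
        where
        double : ∀ σ r → σ ℕ.* (2 ℕ.* r) ≡ σ ℕ.* r ℕ.+ σ ℕ.* r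
        double = ℕ-Solver.solve-∀
      shifted : ∀ X Y → X ℕ.+ σ ℕ.* r < Y ℕ.+ N → X ℕ.+ σ ℕ.* j < Y ℕ.+ σ ℕ.* r ℕ.+ N
      shifted X Y lt = begin-strict
        X ℕ.+ σ ℕ.* j                   ≤⟨ ℕ.+-monoʳ-≤ X σj≤σr+σr ⟩
        X ℕ.+ (σ ℕ.* r ℕ.+ σ ℕ.* r)     ≡⟨ ℕ.+-assoc X _ _ ⟨
        X ℕ.+ σ ℕ.* r ℕ.+ σ ℕ.* r       <⟨ ℕ.+-monoˡ-< (σ ℕ.* r) lt ⟩
        Y ℕ.+ N ℕ.+ σ ℕ.* r             ≡⟨ xy∙z≈xz∙y Y N (σ ℕ.* r) ⟩
        Y ℕ.+ σ ℕ.* r ℕ.+ N             ∎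
        where open ℕ.≤-Reasoning
      widened : ∀ X Y → X < Y ℕ.+ N → X < Y ℕ.+ σ ℕ.* j ℕ.+ N
      widened X Y lt = ℕ.<-≤-trans lt (ℕ.+-monoˡ-≤ N (ℕ.m≤m+n Y (σ ℕ.* j)))
      Q<P+N : ∀ s → lo s k ℕ.+ σ ℕ.* r < hi s k ℕ.+ σ ℕ.* j ℕ.+ N
      Q<P+N true  = widened _ (α k) (lower k k≤c)
      Q<P+N false = widened _ β (upper k k≤c)
      P<Q+N : ∀ s → hi s k ℕ.+ σ ℕ.* j < lo s k ℕ.+ σ ℕ.* r ℕ.+ N
      P<Q+N true  = shifted (α k) β (upper k k≤c)
      P<Q+N false = shifted β (α k) (lower k k≤c)
      P+Q≡odd : ∀ s → hi s k ℕ.+ σ ℕ.* j ℕ.+ (lo s k ℕ.+ σ ℕ.* r) ≡ suc (2 ℕ.* (proj₁ (α+β-odd k) ℕ.+ proj₁ step-even ℕ.* (j ℕ.+ r)))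
      P+Q≡odd s with α+β-odd k | step-even
      ... | w , α+β≡ | h , σ≡2h = begin
        hi s k ℕ.+ σ ℕ.* j ℕ.+ (lo s k ℕ.+ σ ℕ.* r)  ≡⟨ regroup (hi s k) (lo s k) σ j r ⟩
        (hi s k ℕ.+ lo s k) ℕ.+ σ ℕ.* (j ℕ.+ r)      ≡⟨ cong₂ (λ x y → x ℕ.+ y ℕ.* (j ℕ.+ r)) (hi+lo s) σ≡2h ⟩
        (α k ℕ.+ β) ℕ.+ 2 ℕ.* h ℕ.* (j ℕ.+ r)        ≡⟨ cong (ℕ._+ 2 ℕ.* h ℕ.* (j ℕ.+ r)) α+β≡ ⟩
        suc (2 ℕ.* w) ℕ.+ 2 ℕ.* h ℕ.* (j ℕ.+ r)      ≡⟨ ℕ-Solver.solve (w ∷ h ∷ j ∷ r ∷ []) ⟩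
        suc (2 ℕ.* (w ℕ.+ h ℕ.* (j ℕ.+ r)))          ∎
        where
        open ≡-Reasoning
        regroup : ∀ p q σ j r → p ℕ.+ σ ℕ.* j ℕ.+ (q ℕ.+ σ ℕ.* r) ≡ (p ℕ.+ q) ℕ.+ σ ℕ.* (j ℕ.+ r)
        regroup = ℕ-Solver.solve-∀
        hi+lo : ∀ s → hi s k ℕ.+ lo s k ≡ α k ℕ.+ β
        hi+lo true  = refl
        hi+lo false = ℕ.+-comm β (α k)

    reflect : Bool → ℕ → ℕ
    reflect true  j = j
    reflect false j = c ℕ.∸ j

    reflect≤c : ∀ e {j} → j ≤ c → reflect e j ≤ c
    reflect≤c true  j≤c = j≤c
    reflect≤c false {j} _ = ℕ.m∸n≤m c j

    reflect-injective : ∀ e {j j'} → j ≤ c → j' ≤ c → reflect e j ≡ reflect e j' → j ≡ j'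
    reflect-injective true  _   _    eq = eq
    reflect-injective false j≤c j'≤c eq = ℕ.∸-cancelˡ-≡ j≤c j'≤c eq

    sign-progression : ∀ e j → j ≤ c → sign e * progression j ≡ progression (reflect e j)
    sign-progression true  j _   = ℤ.*-identityˡ (progression j)
    sign-progression false j j≤c = begin
      - + 1 * progression j                ≡⟨ ℤ.-1*i≡-i (progression j) ⟩
      - ((step ℕ.* j) ⊖ (step ℕ.* r))      ≡⟨ ℤ.⊖-swap (step ℕ.* r) (step ℕ.* j) ⟨
      (step ℕ.* r) ⊖ (step ℕ.* j)          ≡⟨ +≡+⇒⊖≡⊖ (step ℕ.* r) (step ℕ.* j) (step ℕ.* (c ℕ.∸ j)) (step ℕ.* r) σr+σr≡σ[c∸j]+σj ⟩
      progression (c ℕ.∸ j)                ∎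
      where
      open ≡-Reasoning
      double : ∀ σ r → σ ℕ.* r ℕ.+ σ ℕ.* r ≡ σ ℕ.* (2 ℕ.* r)
      double = ℕ-Solver.solve-∀
      σr+σr≡σ[c∸j]+σj : step ℕ.* r ℕ.+ step ℕ.* r ≡ step ℕ.* (c ℕ.∸ j) ℕ.+ step ℕ.* j
      σr+σr≡σ[c∸j]+σj = trans (double step r)
        (trans (cong (step ℕ.*_) (sym (ℕ.m∸n+n≡m j≤c))) (ℕ.*-distribˡ-+ step (c ℕ.∸ j) j))

    sign-* : ∀ e s → sign e * sign s ≡ sign (not e xor s)
    sign-* true  true  = refl
    sign-* true  false = refl
    sign-* false true  = refl
    sign-* false false = refl

    sign-value : ∀ e s k j → j ≤ c → sign e * value s k j ≡ value (not e xor s) k (reflect e j)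
    sign-value e s k j j≤c = begin
      sign e * (sign s * base k + progression j)         ≡⟨ ℤ.*-distribˡ-+ (sign e) _ _ ⟩
      sign e * (sign s * base k) + sign e * progression j ≡⟨ cong₂ _+_ (sym (ℤ.*-assoc (sign e) (sign s) (base k))) (sign-progression e j j≤c) ⟩
      sign e * sign s * base k + progression (reflect e j) ≡⟨ cong (λ z → z * base k + progression (reflect e j)) (sign-* e s) ⟩
      value (not e xor s) k (reflect e j)                ∎
      where open ≡-Reasoning

module Family (r : ℕ) (1≤r : 1 ≤ r) where
  open import Data.Nat as ℕ using (ℕ; _≤_; _<_; s≤s)
  open import Defs
  open LabelSet
  open Labeling r 1≤r
  open Tilings r 1≤r
  import Data.Nat.Properties as ℕ
  open import Data.Integer as ℤ using (ℤ; _*_)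
  import Data.Integer.Properties as ℤ
  open import Data.Fin using (Fin; toℕ)
  open import Data.Fin.Properties using (toℕ-injective; toℕ<n)
  open import Data.Bool using (Bool; true; false; not; _xor_)
  open import Data.Product using (_,_; proj₂)
  open import Function using (_∘_)
  open import Function.Definitions using (Injective)
  open import Relation.Binary.PropositionalEquality

  signedBase : Tiling → (ℕ → Bool) → ℕ → ℤ
  signedBase D η k = sign (η k) * base D k

  record Class : Set where
    constructor class
    field
      swapped : Bool
      shape   : Shape
      η       : ℕ → Bool

  open Class

  antidiagValues diagValues : Class → ℕ → ℤ
  antidiagValues (class false p η) = signedBase (tiling p) η
  antidiagValues (class true  p η) = progression (tiling p)
  diagValues     (class false p η) = progression (tiling p)
  diagValues     (class true  p η) = signedBase (tiling p) η

  classLabeling : Class → (Fin m → Fin m) → (Fin m → Fin m) → V m → ℤ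
  classLabeling C σ τ = labeling (antidiagValues C ∘ toℕ ∘ σ) (diagValues C ∘ toℕ ∘ τ)

  baseIndex progressionIndex : Class → (Fin m → Fin m) → (Fin m → Fin m) → V m → ℕ
  baseIndex        (class false _ _) σ τ v = toℕ (σ (antidiag v))
  baseIndex        (class true  _ _) σ τ v = toℕ (τ (diag v))
  progressionIndex (class false _ _) σ τ v = toℕ (τ (diag v))
  progressionIndex (class true  _ _) σ τ v = toℕ (σ (antidiag v))

  baseIndex<m : ∀ C σ τ v → baseIndex C σ τ v < m
  baseIndex<m (class false _ _) σ τ v = toℕ<n _
  baseIndex<m (class true  _ _) σ τ v = toℕ<n _

  progressionIndex<m : ∀ C σ τ v → progressionIndex C σ τ v < m
  progressionIndex<m (class false _ _) σ τ v = toℕ<n _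
  progressionIndex<m (class true  _ _) σ τ v = toℕ<n _

  parity : V m → Bool
  parity v = even (toℕ (proj₂ v))

  valueSign : Class → (Fin m → Fin m) → (Fin m → Fin m) → V m → Bool
  valueSign C σ τ v = not (parity v) xor η C (baseIndex C σ τ v)

  valueStep : Class → (Fin m → Fin m) → (Fin m → Fin m) → V m → ℕ
  valueStep C σ τ v = reflect (tiling (shape C)) (parity v) (progressionIndex C σ τ v)

  valueStep<m : ∀ C σ τ v → valueStep C σ τ v < m
  valueStep<m C σ τ v = s≤s (reflect≤c (tiling (shape C)) (parity v) (<m⇒≤c (progressionIndex<m C σ τ v)))

  classLabeling≡value : ∀ C σ τ v →
    classLabeling C σ τ v ≡ value (tiling (shape C)) (valueSign C σ τ v) (baseIndex C σ τ v) (valueStep C σ τ v)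
  classLabeling≡value C@(class false p η) σ τ v =
    sign-value (tiling p) (parity v) (η (baseIndex C σ τ v)) _ _ (<m⇒≤c (progressionIndex<m C σ τ v))
  classLabeling≡value C@(class true p η) σ τ v =
    trans (cong (sign (parity v) *_) (ℤ.+-comm (progression (tiling p) _) (signedBase (tiling p) η _)))
          (sign-value (tiling p) (parity v) (η (baseIndex C σ τ v)) _ _ (<m⇒≤c (progressionIndex<m C σ τ v)))

  not-xor-cancelʳ : ∀ e e' b → not e xor b ≡ not e' xor b → e ≡ e'
  not-xor-cancelʳ true  true  b     _  = refl
  not-xor-cancelʳ false false b     _  = refl
  not-xor-cancelʳ true  false false ()
  not-xor-cancelʳ true  false true  ()
  not-xor-cancelʳ false true  false ()
  not-xor-cancelʳ false true  true  ()

  classLabeling-injective : ∀ C σ τ → Injective _≡_ _≡_ σ → Injective _≡_ _≡_ τ → Injective _≡_ _≡_ (classLabeling C σ τ)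
  classLabeling-injective C σ τ σ-inj τ-inj {v} {v'} eq
    with value-injective (tiling (shape C)) _ _ _ _ _ _ (baseIndex<m C σ τ v) (baseIndex<m C σ τ v') (valueStep<m C σ τ v) (valueStep<m C σ τ v')
           (trans (sym (classLabeling≡value C σ τ v)) (trans eq (classLabeling≡value C σ τ v')))
  ... | same-sign , same-base , same-step = same-indices C same-base same-progression
    where
    same-parity : parity v ≡ parity v'
    same-parity = not-xor-cancelʳ (parity v) (parity v') (η C (baseIndex C σ τ v'))
      (trans (cong (λ k → not (parity v) xor η C k) (sym same-base)) same-sign)
    same-progression : progressionIndex C σ τ v ≡ progressionIndex C σ τ v'
    same-progression = reflect-injective (tiling (shape C)) (parity v) (<m⇒≤c (progressionIndex<m C σ τ v)) (<m⇒≤c (progressionIndex<m C σ τ v'))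
      (trans same-step (cong (λ e → reflect (tiling (shape C)) e (progressionIndex C σ τ v')) (sym same-parity)))
    same-indices : ∀ C → baseIndex C σ τ v ≡ baseIndex C σ τ v' → progressionIndex C σ τ v ≡ progressionIndex C σ τ v' → v ≡ v'
    same-indices (class false _ _) same-k same-j =
      coordinates-injective v v' (σ-inj (toℕ-injective same-k)) (τ-inj (toℕ-injective same-j)) same-parity
    same-indices (class true _ _) same-k same-j =
      coordinates-injective v v' (σ-inj (toℕ-injective same-j)) (τ-inj (toℕ-injective same-k)) same-parity

  classLabeling-distanceMagic : ∀ C σ τ → Injective _≡_ _≡_ σ → Injective _≡_ _≡_ τ →
                                IsDistanceMagicLabeling m (classLabeling C σ τ)
  classLabeling-distanceMagic C σ τ σ-inj τ-inj =
    isBijectionOntoLabels m (classLabeling C σ τ) in-labels (classLabeling-injective C σ τ σ-inj τ-inj) ,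
    labeling-magic (antidiagValues C ∘ toℕ ∘ σ) (diagValues C ∘ toℕ ∘ τ)
    where
    in-labels : ∀ v → InLabelSet (order m) (classLabeling C σ τ v)
    in-labels v = subst (InLabelSet (order m)) (sym (classLabeling≡value C σ τ v))
      (value∈labels (tiling (shape C)) (valueSign C σ τ v) _ _ (baseIndex<m C σ τ v) (valueStep<m C σ τ v))

module Separation (r : ℕ) (1≤r : 1 ≤ r) where
  open import Data.Nat as ℕ using (ℕ; zero; suc; _≤_; _<_; s≤s; z≤n)
  open LabelSet
  open Labeling r 1≤r using (c; m; 2≤c; sign)
  open Tilings r 1≤r
  open Family r 1≤r using (signedBase)
  import Data.Nat.Properties as ℕ
  open import Algebra.Properties.CommutativeSemigroup ℕ.+-commutativeSemigroup using (xy∙z≈xz∙y)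
  import Data.Nat.Tactic.RingSolver as ℕ-Solver
  open import Data.Integer as ℤ using (ℤ; +_; _⊖_; _+_; _*_; -_)
  import Data.Integer.Properties as ℤ
  open import Data.Integer.Tactic.RingSolver using (solve-∀)
  open import Data.Bool using (Bool; true; false)
  open import Data.List using (_∷_; [])
  open import Data.Product using (_×_; _,_; proj₁; proj₂; ∃-syntax)
  open import Data.Sum using (_⊎_; inj₁; inj₂)
  open import Data.Empty using (⊥; ⊥-elim)
  open import Data.Unit using (⊤)
  open import Relation.Binary.PropositionalEquality
  open import Relation.Nullary using (¬_)

  ShiftedValues : (ℕ → ℤ) → (ℕ → ℤ) → ℤ → Set
  ShiftedValues f g d = (∀ k → k < m → ∃[ k' ] k' < m × f k ≡ g k' + d)
                      × (∀ k' → k' < m → ∃[ k ] k < m × f k ≡ g k' + d)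

  ShiftedValues-flip : ∀ {f g d} → ShiftedValues f g d → ShiftedValues g f (- d)
  ShiftedValues-flip {f} {g} {d} (forth , back) =
    (λ k k<m → let k' , k'<m , eq = back k k<m in k' , k'<m , move eq) ,
    (λ k' k'<m → let k , k<m , eq = forth k' k'<m in k , k<m , move eq)
    where
    move : ∀ {x y} → x ≡ y + d → y ≡ x + - d
    move {x} {y} eq = trans (restore y d) (cong (_+ - d) (sym eq))
      where
      restore : ∀ y d → y ≡ (y + d) + - d
      restore = solve-∀

  c<m : c < m
  c<m = ℕ.n<1+n c

  r<m : r < m
  r<m = s≤s (ℕ.m≤m+n r (r ℕ.+ 0))

  shifted-max : ∀ {f g d} → ShiftedValues f g d →
                (∀ k → k < m → f k ℤ.≤ f c) → (∀ k → k < m → g k ℤ.≤ g c) → f c ≡ g c + d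
  shifted-max {f} {g} {d} (forth , back) f≤f[c] g≤g[c] with forth c c<m | back c c<m
  ... | k₁ , k₁<m , f[c]≡ | k₂ , k₂<m , f[k₂]≡ = ℤ.≤-antisym
    (ℤ.≤-trans (ℤ.≤-reflexive f[c]≡) (ℤ.+-monoˡ-≤ d (g≤g[c] k₁ k₁<m)))
    (ℤ.≤-trans (ℤ.≤-reflexive (sym f[k₂]≡)) (f≤f[c] k₂ k₂<m))

  shifted-min : ∀ {f g d} → ShiftedValues f g d →
                (∀ k → k < m → f 0 ℤ.≤ f k) → (∀ k → k < m → g 0 ℤ.≤ g k) → f 0 ≡ g 0 + d
  shifted-min {f} {g} {d} (forth , back) f[0]≤f g[0]≤g with forth 0 (s≤s z≤n) | back 0 (s≤s z≤n)
  ... | k₁ , k₁<m , f[0]≡ | k₂ , k₂<m , f[k₂]≡ = ℤ.≤-antisym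
    (ℤ.≤-trans (f[0]≤f k₂ k₂<m) (ℤ.≤-reflexive f[k₂]≡))
    (ℤ.≤-trans (ℤ.+-monoˡ-≤ d (g[0]≤g k₁ k₁<m)) (ℤ.≤-reflexive (sym f[0]≡)))

  module _ (D : Tiling) where
    open Tiling D

    progression-mono : ∀ {j j'} → j ≤ j' → progression D j ℤ.≤ progression D j'
    progression-mono j≤j' = ℤ.⊖-monoˡ-≤ (step ℕ.* r) (ℕ.*-monoʳ-≤ step j≤j')

    progression-top : progression D c ≡ + (step ℕ.* r)
    progression-top = begin
      (step ℕ.* c) ⊖ (step ℕ.* r)                    ≡⟨ cong (_⊖ (step ℕ.* r)) (double step r) ⟩
      (step ℕ.* r ℕ.+ step ℕ.* r) ⊖ (step ℕ.* r)     ≡⟨ ℤ.⊖-≥ (ℕ.m≤n+m (step ℕ.* r) (step ℕ.* r)) ⟩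
      + (step ℕ.* r ℕ.+ step ℕ.* r ℕ.∸ step ℕ.* r)    ≡⟨ cong +_ (ℕ.m+n∸n≡m (step ℕ.* r) (step ℕ.* r)) ⟩
      + (step ℕ.* r)                                 ∎
      where
      open ≡-Reasoning
      double : ∀ σ r → σ ℕ.* (2 ℕ.* r) ≡ σ ℕ.* r ℕ.+ σ ℕ.* r
      double = ℕ-Solver.solve-∀

    progression-bottom : progression D 0 ≡ - + (step ℕ.* r)
    progression-bottom = begin
      (step ℕ.* 0) ⊖ (step ℕ.* r)  ≡⟨ cong (_⊖ (step ℕ.* r)) (ℕ.*-zeroʳ step) ⟩
      0 ⊖ (step ℕ.* r)             ≡⟨ ℤ.⊖-swap 0 (step ℕ.* r) ⟩
      - + (step ℕ.* r)             ∎
      where open ≡-Reasoning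

  progression-shift : ∀ D D' {d} → ShiftedValues (progression D) (progression D') d →
                      Tiling.step D ≡ Tiling.step D' × d ≡ + 0
  progression-shift D D' {d} shifted = S≡T , d≡0
    where
    S = Tiling.step D
    T = Tiling.step D'
    below-top : ∀ D k → k < m → progression D k ℤ.≤ progression D c
    below-top D k k<m = progression-mono D (<m⇒≤c k<m)
    above-bottom : ∀ D k → k < m → progression D 0 ℤ.≤ progression D k
    above-bottom D k _ = progression-mono D z≤n
    top : + (S ℕ.* r) ≡ + (T ℕ.* r) + d
    top = trans (sym (progression-top D))
                (trans (shifted-max shifted (below-top D) (below-top D')) (cong (_+ d) (progression-top D')))
    bottom : - + (S ℕ.* r) ≡ - + (T ℕ.* r) + d
    bottom = trans (sym (progression-bottom D))
                   (trans (shifted-min shifted (above-bottom D) (above-bottom D')) (cong (_+ d) (progression-bottom D')))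
    2d≡0 : + 2 * d ≡ + 2 * + 0
    2d≡0 = begin
      + 2 * d                                                ≡⟨ regroup (+ (T ℕ.* r)) d ⟩
      ((+ (T ℕ.* r) + d) + (- + (T ℕ.* r) + d)) ℤ.- (+ (T ℕ.* r) + - + (T ℕ.* r))
        ≡⟨ cong₂ (λ x y → (x + y) ℤ.- (+ (T ℕ.* r) + - + (T ℕ.* r))) top bottom ⟨
      (+ (S ℕ.* r) + - + (S ℕ.* r)) ℤ.- (+ (T ℕ.* r) + - + (T ℕ.* r)) ≡⟨ vanish (+ (S ℕ.* r)) (+ (T ℕ.* r)) ⟩
      + 0                                                    ∎
      where
      open ≡-Reasoning
      regroup : ∀ t d → + 2 * d ≡ ((t + d) + (- t + d)) ℤ.- (t + - t)
      regroup = solve-∀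
      vanish : ∀ s t → (s + - s) ℤ.- (t + - t) ≡ + 0
      vanish = solve-∀
    d≡0 : d ≡ + 0
    d≡0 = ℤ.*-cancelˡ-≡ (+ 2) d (+ 0) 2d≡0
    S≡T : S ≡ T
    S≡T = ℕ.*-cancelʳ-≡ S T r {{ℕ.>-nonZero 1≤r}} (ℤ.+-injective (trans top (trans (cong (λ z → + (T ℕ.* r) + z) d≡0) (ℤ.+-identityʳ _))))

  signedBase-injective : ∀ D b b' k k' → k < m → k' < m → sign b * base D k ≡ sign b' * base D k' → b ≡ b' × k ≡ k'
  signedBase-injective D b b' k k' k<m k'<m eq =
    let b≡b' , k≡k' , _ = value-injective D b b' k k' r r k<m k'<m r<m r<m (cong (_+ progression D r) eq)
    in b≡b' , k≡k'

  progression-injective : ∀ D j j' → j < m → j' < m → progression D j ≡ progression D j' → j ≡ j'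
  progression-injective D j j' j<m j'<m eq =
    proj₂ (proj₂ (value-injective D true true 0 0 j j' (s≤s z≤n) (s≤s z≤n) j<m j'<m (cong (λ z → sign true * base D 0 + z) eq)))

  signedBase-cancel : ∀ D η η' → ShiftedValues (signedBase D η) (signedBase D η') (+ 0) → ∀ k → k < m → η k ≡ η' k
  signedBase-cancel D η η' (forth , _) k k<m with forth k k<m
  ... | k' , k'<m , eq with signedBase-injective D (η k) (η' k') k k' k<m k'<m (trans eq (ℤ.+-identityʳ _))
  ... | η≡η' , refl = η≡η'

  ⊖-gap : ∀ p₁ q₁ p₂ q₂ a₁ a₂ b e → p₁ ⊖ q₁ ≡ a₁ ⊖ b + e → p₂ ⊖ q₂ ≡ a₂ ⊖ b + e →
          p₂ ℕ.+ q₁ ℕ.+ a₁ ≡ a₂ ℕ.+ q₂ ℕ.+ p₁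
  ⊖-gap p₁ q₁ p₂ q₂ a₁ a₂ b e eq₁ eq₂ = ℕ.+-cancelʳ-≡ b _ _ (begin
    p₂ ℕ.+ q₁ ℕ.+ a₁ ℕ.+ b       ≡⟨ ℕ-Solver.solve (p₂ ∷ q₁ ∷ a₁ ∷ b ∷ []) ⟩
    p₂ ℕ.+ a₁ ℕ.+ (b ℕ.+ q₁)     ≡⟨ ⊖≡⊖⇒+≡+ (p₂ ℕ.+ a₁) (q₂ ℕ.+ b) (a₂ ℕ.+ p₁) (b ℕ.+ q₁) cross ⟩
    a₂ ℕ.+ p₁ ℕ.+ (q₂ ℕ.+ b)     ≡⟨ ℕ-Solver.solve (a₂ ∷ p₁ ∷ q₂ ∷ b ∷ []) ⟩
    a₂ ℕ.+ q₂ ℕ.+ p₁ ℕ.+ b       ∎)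
    where
    open ≡-Reasoning
    exchange : ∀ x₁ x₂ y₁ y₂ → x₁ ≡ y₁ + e → x₂ ≡ y₂ + e → x₂ + y₁ ≡ y₂ + x₁
    exchange x₁ x₂ y₁ y₂ refl refl = reassociate y₁ y₂ e
      where
      reassociate : ∀ y₁ y₂ e → (y₂ + e) + y₁ ≡ y₂ + (y₁ + e)
      reassociate = solve-∀
    cross : (p₂ ℕ.+ a₁) ⊖ (q₂ ℕ.+ b) ≡ (a₂ ℕ.+ p₁) ⊖ (b ℕ.+ q₁)
    cross = begin
      (p₂ ℕ.+ a₁) ⊖ (q₂ ℕ.+ b)     ≡⟨ ⊖-+-⊖ p₂ q₂ a₁ b ⟨
      (p₂ ⊖ q₂) + (a₁ ⊖ b)         ≡⟨ exchange (p₁ ⊖ q₁) (p₂ ⊖ q₂) (a₁ ⊖ b) (a₂ ⊖ b) eq₁ eq₂ ⟩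
      (a₂ ⊖ b) + (p₁ ⊖ q₁)         ≡⟨ ⊖-+-⊖ a₂ b p₁ q₁ ⟩
      (a₂ ℕ.+ p₁) ⊖ (b ℕ.+ q₁)     ∎

  module _ (D D' : Tiling) (η : ℕ → Bool) (e : ℤ) where

    -- signedBase k₂ − signedBase k₁ = step · (j₂ − j₁), with both sides moved so that no subtraction occurs.
    gap-equation : ∀ k₁ k₂ j₁ j₂ → signedBase D η k₁ ≡ progression D' j₁ + e → signedBase D η k₂ ≡ progression D' j₂ + e →
                   hi D (η k₂) k₂ ℕ.+ lo D (η k₁) k₁ ℕ.+ Tiling.step D' ℕ.* j₁
                   ≡ Tiling.step D' ℕ.* j₂ ℕ.+ lo D (η k₂) k₂ ℕ.+ hi D (η k₁) k₁
    gap-equation k₁ k₂ j₁ j₂ eq₁ eq₂ =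
      ⊖-gap (hi D (η k₁) k₁) (lo D (η k₁) k₁) (hi D (η k₂) k₂) (lo D (η k₂) k₂) (t ℕ.* j₁) (t ℕ.* j₂) (t ℕ.* r) e
            (trans (sym (signed-base D (η k₁) k₁)) eq₁) (trans (sym (signed-base D (η k₂) k₂)) eq₂)
      where t = Tiling.step D'

    step-equation : ∀ {t} → Tiling.step D' ≡ t → ∀ k₁ k₂ j →
                    signedBase D η k₁ ≡ progression D' j + e → signedBase D η k₂ ≡ progression D' (suc j) + e →
                    hi D (η k₂) k₂ ℕ.+ lo D (η k₁) k₁ ≡ t ℕ.+ lo D (η k₂) k₂ ℕ.+ hi D (η k₁) k₁
    step-equation refl k₁ k₂ j eq₁ eq₂ = ℕ.+-cancelʳ-≡ (t ℕ.* j) _ _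
      (trans (gap-equation k₁ k₂ j (suc j) eq₁ eq₂) (regroup t j (lo D (η k₂) k₂) (hi D (η k₁) k₁)))
      where
      t = Tiling.step D'
      regroup : ∀ t j q p → t ℕ.* suc j ℕ.+ q ℕ.+ p ≡ t ℕ.+ q ℕ.+ p ℕ.+ t ℕ.* j
      regroup = ℕ-Solver.solve-∀

  Constant : (ℕ → Bool) → Set
  Constant η = ∀ k → k < m → η k ≡ η 0

  module SignPropagation (D D' : Tiling) (η : ℕ → Bool) (e : ℤ)
    (shifted : ShiftedValues (signedBase D η) (progression D') e)
    (step-keeps-sign : ∀ j k k' → j < c → k < m → k' < m →
                       signedBase D η k ≡ progression D' j + e → signedBase D η k' ≡ progression D' (suc j) + e → η k ≡ η k')
    where

    private
      first = proj₂ shifted 0 (s≤s z≤n)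
      k₀ = proj₁ first
      k₀<m = proj₁ (proj₂ first)
      at-0 = proj₂ (proj₂ first)

    sign-at : ∀ j → j ≤ c → ∀ k → k < m → signedBase D η k ≡ progression D' j + e → η k ≡ η k₀
    sign-at zero    _     k k<m at-j = cong η (proj₂ (signedBase-injective D (η k) (η k₀) k k₀ k<m k₀<m (trans at-j (sym at-0))))
    sign-at (suc j) 1+j≤c k k<m at-j with proj₂ shifted j (ℕ.<-trans 1+j≤c c<m)
    ... | k' , k'<m , at-j' = trans (sym (step-keeps-sign j k' k 1+j≤c k'<m k<m at-j' at-j)) (sign-at j (ℕ.<⇒≤ 1+j≤c) k' k'<m at-j')

    constant : Constant η
    constant k k<m = trans (same k k<m) (sym (same 0 (s≤s z≤n)))
      where
      same : ∀ k → k < m → η k ≡ η k₀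
      same k k<m = let j , j<m , at-j = proj₁ shifted k k<m in sign-at j (<m⇒≤c j<m) k k<m at-j

  module _ where
    open Tiling

    private
      hi-odds≤ : ∀ b k → k ≤ c → hi (tiling odds) b k ≤ suc (2 ℕ.* c)
      hi-odds≤ true  k k≤c = s≤s (ℕ.*-monoʳ-≤ 2 k≤c)
      hi-odds≤ false k k≤c = z≤n

      lo-odds≤ : ∀ b k → k ≤ c → lo (tiling odds) b k ≤ suc (2 ℕ.* c)
      lo-odds≤ true  k k≤c = z≤n
      lo-odds≤ false k k≤c = s≤s (ℕ.*-monoʳ-≤ 2 k≤c)

      4c+3≤2[c+1]c : ∀ c → 2 ≤ c → suc (suc (2 ℕ.* c) ℕ.+ suc (2 ℕ.* c)) ≤ 2 ℕ.* suc c ℕ.* c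
      4c+3≤2[c+1]c (suc (suc c)) (s≤s (s≤s z≤n)) = ℕ.≤-trans (ℕ.m≤m+n _ (2 ℕ.* c ℕ.* c ℕ.+ 6 ℕ.* c ℕ.+ 1)) (ℕ.≤-reflexive (expand c))
        where
        expand : ∀ c → suc (suc (2 ℕ.* suc (suc c)) ℕ.+ suc (2 ℕ.* suc (suc c))) ℕ.+ (2 ℕ.* c ℕ.* c ℕ.+ 6 ℕ.* c ℕ.+ 1)
                       ≡ 2 ℕ.* suc (suc (suc c)) ℕ.* suc (suc c)
        expand = ℕ-Solver.solve-∀

    odds-¬wide : ∀ D' η e → ShiftedValues (signedBase (tiling odds) η) (progression D') e → 2 ℕ.* m ≤ step D' → ⊥
    odds-¬wide D' η e (_ , back) 2m≤t with back 0 (s≤s z≤n) | back c c<m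
    ... | k₁ , k₁<m , at-0 | k₂ , k₂<m , at-c = ℕ.<-irrefl refl (ℕ.≤-trans too-wide (ℕ.≤-trans span gap≤))
      where
      t = step D'
      D = tiling odds
      too-wide : suc (suc (2 ℕ.* c) ℕ.+ suc (2 ℕ.* c)) ≤ t ℕ.* c
      too-wide = ℕ.≤-trans (4c+3≤2[c+1]c c 2≤c) (ℕ.*-monoˡ-≤ c 2m≤t)
      span : t ℕ.* c ≤ hi D (η k₂) k₂ ℕ.+ lo D (η k₁) k₁
      span = begin
        t ℕ.* c                                                ≤⟨ ℕ.m≤m+n (t ℕ.* c) _ ⟩
        t ℕ.* c ℕ.+ (lo D (η k₂) k₂ ℕ.+ hi D (η k₁) k₁)        ≡⟨ ℕ.+-assoc (t ℕ.* c) _ _ ⟨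
        t ℕ.* c ℕ.+ lo D (η k₂) k₂ ℕ.+ hi D (η k₁) k₁          ≡⟨ gap-equation D D' η e k₁ k₂ 0 c at-0 at-c ⟨
        hi D (η k₂) k₂ ℕ.+ lo D (η k₁) k₁ ℕ.+ t ℕ.* 0          ≡⟨ cong (hi D (η k₂) k₂ ℕ.+ lo D (η k₁) k₁ ℕ.+_) (ℕ.*-zeroʳ t) ⟩
        hi D (η k₂) k₂ ℕ.+ lo D (η k₁) k₁ ℕ.+ 0                ≡⟨ ℕ.+-identityʳ _ ⟩
        hi D (η k₂) k₂ ℕ.+ lo D (η k₁) k₁                      ∎
        where open ℕ.≤-Reasoning
      gap≤ : hi D (η k₂) k₂ ℕ.+ lo D (η k₁) k₁ ≤ suc (2 ℕ.* c) ℕ.+ suc (2 ℕ.* c)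
      gap≤ = ℕ.+-mono-≤ (hi-odds≤ (η k₂) k₂ (<m⇒≤c k₂<m)) (lo-odds≤ (η k₁) k₁ (<m⇒≤c k₁<m))

    odds-unit-gap : ∀ b₁ b₂ k₁ k₂ → hi (tiling odds) b₂ k₂ ℕ.+ lo (tiling odds) b₁ k₁ ≡ 2 ℕ.+ lo (tiling odds) b₂ k₂ ℕ.+ hi (tiling odds) b₁ k₁ →
                    b₁ ≡ b₂ ⊎ k₁ ≡ 0 × k₂ ≡ 0
    odds-unit-gap true  true  k₁ k₂ _ = inj₁ refl
    odds-unit-gap false false k₁ k₂ _ = inj₁ refl
    odds-unit-gap true  false k₁ k₂ ()
    odds-unit-gap false true  k₁ k₂ eq = inj₂ (ℕ.m+n≡0⇒n≡0 k₂ k₂+k₁≡0 , ℕ.m+n≡0⇒m≡0 k₂ k₂+k₁≡0)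
      where
      double : ∀ k₂ k₁ → suc (2 ℕ.* k₂) ℕ.+ suc (2 ℕ.* k₁) ≡ 2 ℕ.+ 2 ℕ.* (k₂ ℕ.+ k₁)
      double = ℕ-Solver.solve-∀
      k₂+k₁≡0 : k₂ ℕ.+ k₁ ≡ 0
      k₂+k₁≡0 = ℕ.*-cancelˡ-≡ _ 0 2 (ℕ.+-cancelˡ-≡ 2 _ _ (trans (sym (double k₂ k₁)) eq))

    odds-unit-step⇒constant : ∀ D' η e → ShiftedValues (signedBase (tiling odds) η) (progression D') e → step D' ≡ 2 → Constant η
    odds-unit-step⇒constant D' η e shifted t≡2 = SignPropagation.constant (tiling odds) D' η e shifted same-sign
      where
      same-sign : ∀ j k k' → j < c → k < m → k' < m → _ → _ → η k ≡ η k'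
      same-sign j k k' _ _ _ at-j at-j+1 with odds-unit-gap (η k) (η k') k k' (step-equation (tiling odds) D' η e t≡2 k k' j at-j at-j+1)
      ... | inj₁ η≡η'          = η≡η'
      ... | inj₂ (refl , refl) = refl

    private
      m*≢1+m* : ∀ x y → m ℕ.* x ≢ 1 ℕ.+ m ℕ.* y
      m*≢1+m* x y eq = ℕ.0≢1+n (proj₁ (digits-unique m 0 1 x y (s≤s z≤n) 1<m eq))

    oddMultiples-¬unit-step : ∀ D' η e → ShiftedValues (signedBase (tiling oddMultiples) η) (progression D') e → step D' ≡ 2 → ⊥
    oddMultiples-¬unit-step D' η e (_ , back) t≡2 with back 0 (s≤s z≤n) | back 1 (ℕ.<-trans (s≤s (s≤s z≤n)) (s≤s 2≤c))
    ... | k₁ , _ , at-0 | k₂ , _ , at-1 =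
      impossible (η k₁) (η k₂) (step-equation D D' η e t≡2 k₁ k₂ 0 at-0 at-1)
      where
      D = tiling oddMultiples
      halve : ∀ m x y → m ℕ.* suc (2 ℕ.* x) ≡ 2 ℕ.+ m ℕ.* suc (2 ℕ.* y) → 2 ℕ.* (m ℕ.* x) ≡ 2 ℕ.* (1 ℕ.+ m ℕ.* y)
      halve m x y eq = ℕ.+-cancelˡ-≡ m _ _ (trans (sym (odd m x)) (trans eq (trans (cong (2 ℕ.+_) (odd m y)) (shuffle m y))))
        where
        odd : ∀ m x → m ℕ.* suc (2 ℕ.* x) ≡ m ℕ.+ 2 ℕ.* (m ℕ.* x)
        odd = ℕ-Solver.solve-∀
        shuffle : ∀ m y → 2 ℕ.+ (m ℕ.+ 2 ℕ.* (m ℕ.* y)) ≡ m ℕ.+ 2 ℕ.* (1 ℕ.+ m ℕ.* y)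
        shuffle = ℕ-Solver.solve-∀
      apart : ∀ x y → m ℕ.* suc (2 ℕ.* x) ≢ 2 ℕ.+ m ℕ.* suc (2 ℕ.* y)
      apart x y eq = m*≢1+m* x y (ℕ.*-cancelˡ-≡ _ _ 2 (halve m x y eq))
      impossible : ∀ b₁ b₂ → hi D b₂ k₂ ℕ.+ lo D b₁ k₁ ≢ 2 ℕ.+ lo D b₂ k₂ ℕ.+ hi D b₁ k₁
      impossible true  true  eq = apart k₂ k₁ (trans (sym (ℕ.+-identityʳ _)) eq)
      impossible false false eq = apart k₁ k₂ (trans eq (ℕ.+-identityʳ _))
      impossible true  false ()
      impossible false true  eq = ℕ.<⇒≱ (s≤s 2≤c) (begin
        m                                                          ≤⟨ ℕ.m≤m*n m (suc (2 ℕ.* k₂)) ⟩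
        m ℕ.* suc (2 ℕ.* k₂)                                       ≤⟨ ℕ.m≤m+n _ _ ⟩
        m ℕ.* suc (2 ℕ.* k₂) ℕ.+ m ℕ.* suc (2 ℕ.* k₁)              ≡⟨ eq ⟩
        2 ℕ.+ 0 ℕ.+ 0                                              ∎)
        where open ℕ.≤-Reasoning

    private
      R = 4 ℕ.* m ℕ.* r

      4m*≢t+4m* : ∀ {t} → t ≡ 2 ⊎ t ≡ 4 ⊎ t ≡ 2 ℕ.* m → ∀ X Y → 4 ℕ.* m ℕ.* X ≢ t ℕ.+ 4 ℕ.* m ℕ.* Y
      4m*≢t+4m* (inj₁ refl) X Y eq = ℕ.even≢odd (m ℕ.* X) (m ℕ.* Y) (ℕ.*-cancelˡ-≡ _ _ 2 (trans (l m X) (trans eq (r′ m Y))))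
        where
        l : ∀ m X → 2 ℕ.* (2 ℕ.* (m ℕ.* X)) ≡ 4 ℕ.* m ℕ.* X
        l = ℕ-Solver.solve-∀
        r′ : ∀ m Y → 2 ℕ.+ 4 ℕ.* m ℕ.* Y ≡ 2 ℕ.* suc (2 ℕ.* (m ℕ.* Y))
        r′ = ℕ-Solver.solve-∀
      4m*≢t+4m* (inj₂ (inj₁ refl)) X Y eq = m*≢1+m* X Y (ℕ.*-cancelˡ-≡ _ _ 4 (trans (l m X) (trans eq (r′ m Y))))
        where
        l : ∀ m X → 4 ℕ.* (m ℕ.* X) ≡ 4 ℕ.* m ℕ.* X
        l = ℕ-Solver.solve-∀
        r′ : ∀ m Y → 4 ℕ.+ 4 ℕ.* m ℕ.* Y ≡ 4 ℕ.* (1 ℕ.+ m ℕ.* Y)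
        r′ = ℕ-Solver.solve-∀
      4m*≢t+4m* (inj₂ (inj₂ refl)) X Y eq = ℕ.even≢odd X Y (ℕ.*-cancelˡ-≡ _ _ (2 ℕ.* m) (trans (l m X) (trans eq (r′ m Y))))
        where
        l : ∀ m X → 2 ℕ.* m ℕ.* (2 ℕ.* X) ≡ 4 ℕ.* m ℕ.* X
        l = ℕ-Solver.solve-∀
        r′ : ∀ m Y → 2 ℕ.* m ℕ.+ 4 ℕ.* m ℕ.* Y ≡ 2 ℕ.* m ℕ.* suc (2 ℕ.* Y)
        r′ = ℕ-Solver.solve-∀

      descending-gap : ∀ {t} → t ≡ 2 ⊎ t ≡ 4 ⊎ t ≡ 2 ℕ.* m → ∀ X Y → R ℕ.+ R ≢ t ℕ.+ suc (4 ℕ.* m ℕ.* X) ℕ.+ suc (4 ℕ.* m ℕ.* Y)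
      descending-gap (inj₁ refl) X Y eq = m*≢1+m* (2 ℕ.* r) (X ℕ.+ Y) (ℕ.*-cancelˡ-≡ _ _ 4 (trans (l m r) (trans eq (r′ m X Y))))
        where
        l : ∀ m r → 4 ℕ.* (m ℕ.* (2 ℕ.* r)) ≡ 4 ℕ.* m ℕ.* r ℕ.+ 4 ℕ.* m ℕ.* r
        l = ℕ-Solver.solve-∀
        r′ : ∀ m X Y → 2 ℕ.+ suc (4 ℕ.* m ℕ.* X) ℕ.+ suc (4 ℕ.* m ℕ.* Y) ≡ 4 ℕ.* (1 ℕ.+ m ℕ.* (X ℕ.+ Y))
        r′ = ℕ-Solver.solve-∀
      descending-gap (inj₂ (inj₁ refl)) X Y eq = ℕ.even≢odd (2 ℕ.* m ℕ.* r) (1 ℕ.+ m ℕ.* (X ℕ.+ Y)) (ℕ.*-cancelˡ-≡ _ _ 2 (trans (l m r) (trans eq (r′ m X Y))))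
        where
        l : ∀ m r → 2 ℕ.* (2 ℕ.* (2 ℕ.* m ℕ.* r)) ≡ 4 ℕ.* m ℕ.* r ℕ.+ 4 ℕ.* m ℕ.* r
        l = ℕ-Solver.solve-∀
        r′ : ∀ m X Y → 4 ℕ.+ suc (4 ℕ.* m ℕ.* X) ℕ.+ suc (4 ℕ.* m ℕ.* Y) ≡ 2 ℕ.* suc (2 ℕ.* (1 ℕ.+ m ℕ.* (X ℕ.+ Y)))
        r′ = ℕ-Solver.solve-∀
      descending-gap (inj₂ (inj₂ refl)) X Y eq = m*≢1+m* (4 ℕ.* r) (1 ℕ.+ 2 ℕ.* (X ℕ.+ Y)) (ℕ.*-cancelˡ-≡ _ _ 2 (trans (l m r) (trans eq (r′ m X Y))))
        where
        l : ∀ m r → 2 ℕ.* (m ℕ.* (4 ℕ.* r)) ≡ 4 ℕ.* m ℕ.* r ℕ.+ 4 ℕ.* m ℕ.* r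
        l = ℕ-Solver.solve-∀
        r′ : ∀ m X Y → 2 ℕ.* m ℕ.+ suc (4 ℕ.* m ℕ.* X) ℕ.+ suc (4 ℕ.* m ℕ.* Y) ≡ 2 ℕ.* (1 ℕ.+ m ℕ.* (1 ℕ.+ 2 ℕ.* (X ℕ.+ Y)))
        r′ = ℕ-Solver.solve-∀

      ascending-gap : ∀ {t} → t ≡ 4 ⊎ t ≡ 2 ℕ.* m → ∀ X Y → suc (4 ℕ.* m ℕ.* X) ℕ.+ suc (4 ℕ.* m ℕ.* Y) ≢ t ℕ.+ R ℕ.+ R
      ascending-gap (inj₁ refl) X Y eq = ℕ.even≢odd (1 ℕ.+ 2 ℕ.* m ℕ.* r) (m ℕ.* (X ℕ.+ Y)) (ℕ.*-cancelˡ-≡ _ _ 2 (trans (l m r) (trans (sym eq) (r′ m X Y))))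
        where
        l : ∀ m r → 2 ℕ.* (2 ℕ.* (1 ℕ.+ 2 ℕ.* m ℕ.* r)) ≡ 4 ℕ.+ 4 ℕ.* m ℕ.* r ℕ.+ 4 ℕ.* m ℕ.* r
        l = ℕ-Solver.solve-∀
        r′ : ∀ m X Y → suc (4 ℕ.* m ℕ.* X) ℕ.+ suc (4 ℕ.* m ℕ.* Y) ≡ 2 ℕ.* suc (2 ℕ.* (m ℕ.* (X ℕ.+ Y)))
        r′ = ℕ-Solver.solve-∀
      ascending-gap (inj₂ refl) X Y eq = m*≢1+m* (1 ℕ.+ 4 ℕ.* r) (2 ℕ.* (X ℕ.+ Y)) (ℕ.*-cancelˡ-≡ _ _ 2 (trans (l m r) (trans (sym eq) (r′ m X Y))))
        where
        l : ∀ m r → 2 ℕ.* (m ℕ.* (1 ℕ.+ 4 ℕ.* r)) ≡ 2 ℕ.* m ℕ.+ 4 ℕ.* m ℕ.* r ℕ.+ 4 ℕ.* m ℕ.* r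
        l = ℕ-Solver.solve-∀
        r′ : ∀ m X Y → suc (4 ℕ.* m ℕ.* X) ℕ.+ suc (4 ℕ.* m ℕ.* Y) ≡ 2 ℕ.* (1 ℕ.+ m ℕ.* (2 ℕ.* (X ℕ.+ Y)))
        r′ = ℕ-Solver.solve-∀

      cancel-ends : ∀ A B t R → suc A ℕ.+ R ≡ t ℕ.+ R ℕ.+ suc B → A ≡ t ℕ.+ B
      cancel-ends A B t R eq = ℕ.+-cancelʳ-≡ R _ _ (ℕ.suc-injective (trans eq (regroup t R B)))
        where
        regroup : ∀ t R B → t ℕ.+ R ℕ.+ suc B ≡ suc (t ℕ.+ B ℕ.+ R)
        regroup = ℕ-Solver.solve-∀

    nearMultiples-step : ∀ {t} → t ≡ 2 ⊎ t ≡ 4 ⊎ t ≡ 2 ℕ.* m → ∀ b₁ b₂ k₁ k₂ →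
      hi (tiling nearMultiples) b₂ k₂ ℕ.+ lo (tiling nearMultiples) b₁ k₁ ≡ t ℕ.+ lo (tiling nearMultiples) b₂ k₂ ℕ.+ hi (tiling nearMultiples) b₁ k₁ →
      t ≡ 2 × b₁ ≡ false × b₂ ≡ true
    nearMultiples-step {t} t∈ true  true  k₁ k₂ eq = ⊥-elim (4m*≢t+4m* t∈ k₂ k₁ (cancel-ends (4 ℕ.* m ℕ.* k₂) (4 ℕ.* m ℕ.* k₁) t R eq))
    nearMultiples-step {t} t∈ false false k₁ k₂ eq = ⊥-elim (4m*≢t+4m* t∈ k₁ k₂ (cancel-ends (4 ℕ.* m ℕ.* k₁) (4 ℕ.* m ℕ.* k₂) t R
      (trans (ℕ.+-comm (suc (4 ℕ.* m ℕ.* k₁)) R) (trans eq (xy∙z≈xz∙y t (suc (4 ℕ.* m ℕ.* k₂)) R)))))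
    nearMultiples-step t∈ true  false k₁ k₂ eq = ⊥-elim (descending-gap t∈ k₂ k₁ eq)
    nearMultiples-step (inj₁ t≡2)          false true k₁ k₂ eq = t≡2 , refl , refl
    nearMultiples-step (inj₂ (inj₁ t≡4))   false true k₁ k₂ eq = ⊥-elim (ascending-gap (inj₁ t≡4) k₂ k₁ eq)
    nearMultiples-step (inj₂ (inj₂ t≡2m))  false true k₁ k₂ eq = ⊥-elim (ascending-gap (inj₂ t≡2m) k₂ k₁ eq)

    nearMultiples-¬step : ∀ D' η e → ShiftedValues (signedBase (tiling nearMultiples) η) (progression D') e →
                          step D' ≡ 4 ⊎ step D' ≡ 2 ℕ.* m → ⊥
    nearMultiples-¬step D' η e (_ , back) t∈ with back 0 (s≤s z≤n) | back 1 1<m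
    ... | k₁ , _ , at-0 | k₂ , _ , at-1 with t∈
    ...   | inj₁ t≡4 = ℕ.<⇒≢ (s≤s (s≤s (s≤s z≤n))) (sym (proj₁ (nearMultiples-step (inj₂ (inj₁ refl)) (η k₁) (η k₂) k₁ k₂
                                      (step-equation (tiling nearMultiples) D' η e t≡4 k₁ k₂ 0 at-0 at-1))))
    ...   | inj₂ t≡2m = ℕ.<⇒≢ (ℕ.*-monoʳ-< 2 1<m) (sym (proj₁ (nearMultiples-step (inj₂ (inj₂ refl)) (η k₁) (η k₂) k₁ k₂
                                      (step-equation (tiling nearMultiples) D' η e t≡2m k₁ k₂ 0 at-0 at-1))))

    nearMultiples-¬unit-step : ∀ D' η e → ShiftedValues (signedBase (tiling nearMultiples) η) (progression D') e → step D' ≡ 2 → ⊥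
    nearMultiples-¬unit-step D' η e (_ , back) t≡2 with back 0 (s≤s z≤n) | back 1 1<m | back 2 (s≤s 2≤c)
    ... | k₀ , _ , at-0 | k₁ , _ , at-1 | k₂ , _ , at-2
      with nearMultiples-step (inj₁ refl) (η k₀) (η k₁) k₀ k₁ (step-equation (tiling nearMultiples) D' η e t≡2 k₀ k₁ 0 at-0 at-1)
         | nearMultiples-step (inj₁ refl) (η k₁) (η k₂) k₁ k₂ (step-equation (tiling nearMultiples) D' η e t≡2 k₁ k₂ 1 at-1 at-2)
    ... | _ , _ , η₁≡true | _ , η₁≡false , _ with trans (sym η₁≡true) η₁≡false
    ... | ()

    nearMultiples-wide-gap : ∀ b₁ b₂ k₁ k₂ j₁ j₂ →
      hi (tiling nearMultiples) b₂ k₂ ℕ.+ lo (tiling nearMultiples) b₁ k₁ ℕ.+ 4 ℕ.* m ℕ.* j₁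
      ≡ 4 ℕ.* m ℕ.* j₂ ℕ.+ lo (tiling nearMultiples) b₂ k₂ ℕ.+ hi (tiling nearMultiples) b₁ k₁ → b₁ ≡ b₂
    nearMultiples-wide-gap true  true  _ _ _ _ _ = refl
    nearMultiples-wide-gap false false _ _ _ _ _ = refl
    nearMultiples-wide-gap true false k₁ k₂ j₁ j₂ eq =
      ⊥-elim (ℕ.even≢odd (m ℕ.* (2 ℕ.* r ℕ.+ j₁)) (m ℕ.* (j₂ ℕ.+ k₂ ℕ.+ k₁)) (ℕ.*-cancelˡ-≡ _ _ 2 (trans (l m r j₁) (trans eq (r′ m j₂ k₂ k₁)))))
      where
      l : ∀ m r j₁ → 2 ℕ.* (2 ℕ.* (m ℕ.* (2 ℕ.* r ℕ.+ j₁))) ≡ 4 ℕ.* m ℕ.* r ℕ.+ 4 ℕ.* m ℕ.* r ℕ.+ 4 ℕ.* m ℕ.* j₁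
      l = ℕ-Solver.solve-∀
      r′ : ∀ m j₂ k₂ k₁ → 4 ℕ.* m ℕ.* j₂ ℕ.+ suc (4 ℕ.* m ℕ.* k₂) ℕ.+ suc (4 ℕ.* m ℕ.* k₁) ≡ 2 ℕ.* suc (2 ℕ.* (m ℕ.* (j₂ ℕ.+ k₂ ℕ.+ k₁)))
      r′ = ℕ-Solver.solve-∀
    nearMultiples-wide-gap false true k₁ k₂ j₁ j₂ eq =
      ⊥-elim (ℕ.even≢odd (m ℕ.* (j₂ ℕ.+ 2 ℕ.* r)) (m ℕ.* (k₂ ℕ.+ k₁ ℕ.+ j₁)) (ℕ.*-cancelˡ-≡ _ _ 2 (trans (l m j₂ r) (trans (sym eq) (r′ m k₂ k₁ j₁)))))
      where
      l : ∀ m j₂ r → 2 ℕ.* (2 ℕ.* (m ℕ.* (j₂ ℕ.+ 2 ℕ.* r))) ≡ 4 ℕ.* m ℕ.* j₂ ℕ.+ 4 ℕ.* m ℕ.* r ℕ.+ 4 ℕ.* m ℕ.* r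
      l = ℕ-Solver.solve-∀
      r′ : ∀ m k₂ k₁ j₁ → suc (4 ℕ.* m ℕ.* k₂) ℕ.+ suc (4 ℕ.* m ℕ.* k₁) ℕ.+ 4 ℕ.* m ℕ.* j₁ ≡ 2 ℕ.* suc (2 ℕ.* (m ℕ.* (k₂ ℕ.+ k₁ ℕ.+ j₁)))
      r′ = ℕ-Solver.solve-∀

    nearMultiples-wide⇒constant : ∀ D' η e → ShiftedValues (signedBase (tiling nearMultiples) η) (progression D') e →
                                  step D' ≡ 4 ℕ.* m → Constant η
    nearMultiples-wide⇒constant D' η e (forth , _) refl k k<m with forth k k<m | forth 0 (s≤s z≤n)
    ... | j , _ , at-j | j₀ , _ , at-j₀ =
      sym (nearMultiples-wide-gap (η 0) (η k) 0 k j₀ j (gap-equation (tiling nearMultiples) D' η e 0 k j₀ j at-j₀ at-j))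

    private
      2[cm+1]≤ : ∀ k₁ k₂ → suc (c ℕ.* m) ℕ.+ suc (c ℕ.* m) ≤ suc (2 ℕ.* k₂ ℕ.+ c ℕ.* m) ℕ.+ suc (2 ℕ.* k₁ ℕ.+ c ℕ.* m)
      2[cm+1]≤ k₁ k₂ = ℕ.+-mono-≤ (s≤s (ℕ.m≤n+m _ _)) (s≤s (ℕ.m≤n+m _ _))

      4m<2[cm+1] : 4 ℕ.* m < suc (c ℕ.* m) ℕ.+ suc (c ℕ.* m)
      4m<2[cm+1] = begin-strict
        4 ℕ.* m                          ≡⟨ ℕ.*-distribʳ-+ m 2 2 ⟩
        2 ℕ.* m ℕ.+ 2 ℕ.* m              <⟨ s≤s (ℕ.+-mono-≤ 2m≤cm (ℕ.≤-trans 2m≤cm (ℕ.n≤1+n _))) ⟩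
        suc (c ℕ.* m) ℕ.+ suc (c ℕ.* m)  ∎
        where
        open ℕ.≤-Reasoning
        2m≤cm : 2 ℕ.* m ≤ c ℕ.* m
        2m≤cm = ℕ.*-monoˡ-≤ m 2≤c

    nearSquare-step : ∀ {t} → t ≤ 4 ℕ.* m → ∀ b₁ b₂ k₁ k₂ →
      hi (tiling nearSquare) b₂ k₂ ℕ.+ lo (tiling nearSquare) b₁ k₁ ≡ t ℕ.+ lo (tiling nearSquare) b₂ k₂ ℕ.+ hi (tiling nearSquare) b₁ k₁ →
      b₁ ≡ b₂
    nearSquare-step t≤4m true  true  k₁ k₂ eq = refl
    nearSquare-step t≤4m false false k₁ k₂ eq = refl
    nearSquare-step {t} t≤4m true false k₁ k₂ eq = ⊥-elim (ℕ.1+n≢0 (ℕ.m+n≡0⇒n≡0 (t ℕ.+ suc (2 ℕ.* k₂ ℕ.+ c ℕ.* m)) (sym eq)))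
    nearSquare-step {t} t≤4m false true k₁ k₂ eq = ⊥-elim (ℕ.<⇒≱ 4m<2[cm+1] (begin
      suc (c ℕ.* m) ℕ.+ suc (c ℕ.* m)                                   ≤⟨ 2[cm+1]≤ k₁ k₂ ⟩
      suc (2 ℕ.* k₂ ℕ.+ c ℕ.* m) ℕ.+ suc (2 ℕ.* k₁ ℕ.+ c ℕ.* m)         ≡⟨ eq ⟩
      t ℕ.+ 0 ℕ.+ 0                                                      ≡⟨ trans (ℕ.+-identityʳ _) (ℕ.+-identityʳ t) ⟩
      t                                                                  ≤⟨ t≤4m ⟩
      4 ℕ.* m                                                            ∎))
      where open ℕ.≤-Reasoning

    private
      small-spread : ∀ t x y → x ≤ c → 2 ℕ.* x ≡ t ℕ.* c ℕ.+ 2 ℕ.* y → t ≤ 2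
      small-spread t x y x≤c eq = ℕ.*-cancelʳ-≤ t 2 c {{ℕ.>-nonZero (ℕ.<-≤-trans (s≤s z≤n) 2≤c)}} (begin
        t ℕ.* c                 ≤⟨ ℕ.m≤m+n (t ℕ.* c) (2 ℕ.* y) ⟩
        t ℕ.* c ℕ.+ 2 ℕ.* y     ≡⟨ eq ⟨
        2 ℕ.* x                 ≤⟨ ℕ.*-monoʳ-≤ 2 x≤c ⟩
        2 ℕ.* c                 ∎)
        where open ℕ.≤-Reasoning

      endpoints : ∀ b k₀ k₁ t → k₀ ≤ c → k₁ ≤ c →
        hi (tiling nearSquare) b k₁ ℕ.+ lo (tiling nearSquare) b k₀ ℕ.+ t ℕ.* 0 ≡ t ℕ.* c ℕ.+ lo (tiling nearSquare) b k₁ ℕ.+ hi (tiling nearSquare) b k₀ →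
        t ≤ 2
      endpoints true k₀ k₁ t _ k₁≤c eq = small-spread t k₁ k₀ k₁≤c (ℕ.+-cancelʳ-≡ (c ℕ.* m) _ _ (ℕ.suc-injective
        (trans (sym (l k₁ (c ℕ.* m) t)) (trans eq (r′ k₀ (c ℕ.* m) (t ℕ.* c))))))
        where
        l : ∀ k cm t → suc (2 ℕ.* k ℕ.+ cm) ℕ.+ 0 ℕ.+ t ℕ.* 0 ≡ suc (2 ℕ.* k ℕ.+ cm)
        l = ℕ-Solver.solve-∀
        r′ : ∀ k cm tc → tc ℕ.+ 0 ℕ.+ suc (2 ℕ.* k ℕ.+ cm) ≡ suc (tc ℕ.+ 2 ℕ.* k ℕ.+ cm)
        r′ = ℕ-Solver.solve-∀
      endpoints false k₀ k₁ t k₀≤c _ eq = small-spread t k₀ k₁ k₀≤c (ℕ.+-cancelʳ-≡ (c ℕ.* m) _ _ (ℕ.suc-injective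
        (trans (sym (l k₀ (c ℕ.* m) t)) (trans eq (r′ k₁ (c ℕ.* m) (t ℕ.* c))))))
        where
        l : ∀ k cm t → 0 ℕ.+ suc (2 ℕ.* k ℕ.+ cm) ℕ.+ t ℕ.* 0 ≡ suc (2 ℕ.* k ℕ.+ cm)
        l = ℕ-Solver.solve-∀
        r′ : ∀ k cm tc → tc ℕ.+ suc (2 ℕ.* k ℕ.+ cm) ℕ.+ 0 ≡ suc (tc ℕ.+ 2 ℕ.* k ℕ.+ cm)
        r′ = ℕ-Solver.solve-∀

    module _ (D' : Tiling) (η : ℕ → Bool) (e : ℤ) (shifted : ShiftedValues (signedBase (tiling nearSquare) η) (progression D') e)
             (t≤4m : step D' ≤ 4 ℕ.* m) where

      private
        same-sign : ∀ j k k' → j < c → k < m → k' < m → signedBase (tiling nearSquare) η k ≡ progression D' j + e →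
                    signedBase (tiling nearSquare) η k' ≡ progression D' (suc j) + e → η k ≡ η k'
        same-sign j k k' _ _ _ at-j at-j+1 =
          nearSquare-step t≤4m (η k) (η k') k k' (step-equation (tiling nearSquare) D' η e refl k k' j at-j at-j+1)

      open SignPropagation (tiling nearSquare) D' η e shifted same-sign

      nearSquare-constant : Constant η
      nearSquare-constant = constant

      nearSquare-¬wide : 2 < step D' → ⊥
      nearSquare-¬wide 2<t with proj₂ shifted 0 (s≤s z≤n) | proj₂ shifted c c<m
      ... | k₀ , k₀<m , at-0 | k₁ , k₁<m , at-c = ℕ.<⇒≱ 2<t (endpoints (η k₀) k₀ k₁ (step D') (<m⇒≤c k₀<m) (<m⇒≤c k₁<m)
            (subst (λ b → hi D b k₁ ℕ.+ lo D (η k₀) k₀ ℕ.+ step D' ℕ.* 0 ≡ step D' ℕ.* c ℕ.+ lo D b k₁ ℕ.+ hi D (η k₀) k₀) same-end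
                   (gap-equation (tiling nearSquare) D' η e k₀ k₁ 0 c at-0 at-c)))
        where
        D = tiling nearSquare
        same-end : η k₁ ≡ η k₀
        same-end = trans (sign-at c ℕ.≤-refl k₁ k₁<m at-c) (sym (sign-at 0 z≤n k₀ k₀<m at-0))

  -- On the other shapes a constant sign pattern reproduces labelings of another class; e.g. nearSquare
  -- with swapped sides and all signs + gives those of oddMultiples with all signs +, G and H shifted by ±m².
  Admissible : Shape → (ℕ → Bool) → Set
  Admissible oddMultiples  η = ⊤
  Admissible odds          η = ¬ Constant η
  Admissible nearMultiples η = ¬ Constant η
  Admissible nearSquare    η = ¬ Constant η

  private
    2m≤4m : 2 ℕ.* m ≤ 4 ℕ.* m
    2m≤4m = ℕ.*-monoˡ-≤ m {2} {4} (s≤s (s≤s z≤n))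

    4≤4m : 4 ≤ 4 ℕ.* m
    4≤4m = ℕ.m≤m*n 4 m

    2<2m : 2 < 2 ℕ.* m
    2<2m = ℕ.*-monoʳ-< 2 1<m

    2<4 : 2 < 4
    2<4 = s≤s (s≤s (s≤s z≤n))

  crossed-shifts-impossible : ∀ p q η η' {e e'} → Admissible p η → Admissible q η' →
    ShiftedValues (signedBase (tiling p) η) (progression (tiling q)) e →
    ShiftedValues (signedBase (tiling q) η') (progression (tiling p)) e' → ⊥
  crossed-shifts-impossible odds odds η η' _ _ s _ = odds-¬wide (tiling odds) η _ s 2m≤4m
  crossed-shifts-impossible odds oddMultiples η η' ¬const _ s _ = ¬const (odds-unit-step⇒constant (tiling oddMultiples) η _ s refl)
  crossed-shifts-impossible odds nearMultiples η η' _ ¬const' _ s' = ¬const' (nearMultiples-wide⇒constant (tiling odds) η' _ s' refl)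
  crossed-shifts-impossible odds nearSquare η η' _ _ s _ = odds-¬wide (tiling nearSquare) η _ s ℕ.≤-refl
  crossed-shifts-impossible oddMultiples odds η η' _ ¬const' _ s' = ¬const' (odds-unit-step⇒constant (tiling oddMultiples) η' _ s' refl)
  crossed-shifts-impossible oddMultiples oddMultiples η η' _ _ s _ = oddMultiples-¬unit-step (tiling oddMultiples) η _ s refl
  crossed-shifts-impossible oddMultiples nearMultiples η η' _ _ _ s' = nearMultiples-¬unit-step (tiling oddMultiples) η' _ s' refl
  crossed-shifts-impossible oddMultiples nearSquare η η' _ ¬const' _ s' = ¬const' (nearSquare-constant (tiling oddMultiples) η' _ s' (ℕ.≤-trans (s≤s (s≤s z≤n)) 4≤4m))
  crossed-shifts-impossible nearMultiples odds η η' ¬const _ s _ = ¬const (nearMultiples-wide⇒constant (tiling odds) η _ s refl)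
  crossed-shifts-impossible nearMultiples oddMultiples η η' _ _ s _ = nearMultiples-¬unit-step (tiling oddMultiples) η _ s refl
  crossed-shifts-impossible nearMultiples nearMultiples η η' _ _ s _ = nearMultiples-¬step (tiling nearMultiples) η _ s (inj₁ refl)
  crossed-shifts-impossible nearMultiples nearSquare η η' _ _ s _ = nearMultiples-¬step (tiling nearSquare) η _ s (inj₂ refl)
  crossed-shifts-impossible nearSquare odds η η' _ _ s _ = nearSquare-¬wide (tiling odds) η _ s ℕ.≤-refl (ℕ.<-≤-trans 2<4 4≤4m)
  crossed-shifts-impossible nearSquare oddMultiples η η' ¬const _ s _ = ¬const (nearSquare-constant (tiling oddMultiples) η _ s (ℕ.≤-trans (s≤s (s≤s z≤n)) 4≤4m))
  crossed-shifts-impossible nearSquare nearMultiples η η' _ _ s _ = nearSquare-¬wide (tiling nearMultiples) η _ s 4≤4m 2<4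
  crossed-shifts-impossible nearSquare nearSquare η η' _ _ s _ = nearSquare-¬wide (tiling nearSquare) η _ s 2m≤4m 2<2m

module Distinctness (r : ℕ) (1≤r : 1 ≤ r) where
  open import Data.Nat as ℕ using (ℕ; _≤_; _<_; s≤s; z≤n)
  open import Defs
  open LabelSet
  open Labeling r 1≤r
  open Tilings r 1≤r
  open Family r 1≤r
  open Separation r 1≤r
  import Data.Nat.Properties as ℕ
  open import Data.Integer as ℤ using (ℤ; +_; _+_)
  import Data.Integer.Properties as ℤ
  open import Data.Fin using (Fin; toℕ; fromℕ<)
  open import Data.Fin.Properties using (toℕ-injective; toℕ<n; toℕ-fromℕ<)
  open import Data.Bool using (true; false)
  open import Data.Product using (_×_; _,_; proj₂; ∃-syntax)
  open import Data.Empty using (⊥-elim)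
  open import Function using (_∘_)
  open import Function.Definitions using (Injective)
  open import Relation.Binary.PropositionalEquality

  private
    2<2m : 2 < 2 ℕ.* m
    2<2m = ℕ.*-monoʳ-< 2 1<m

    4<4m : 4 < 4 ℕ.* m
    4<4m = ℕ.*-monoʳ-< 4 1<m

    2<4m : 2 < 4 ℕ.* m
    2<4m = ℕ.<-trans (s≤s (s≤s (s≤s z≤n))) 4<4m

    4<2m : 4 < 2 ℕ.* m
    4<2m = ℕ.<-trans (ℕ.n<1+n 4) (ℕ.*-monoʳ-≤ 2 (s≤s 2≤c))

    2m<4m : 2 ℕ.* m < 4 ℕ.* m
    2m<4m = ℕ.*-monoˡ-< m {2} {4} (s≤s (s≤s (s≤s z≤n)))

  step-injective : ∀ p q → Tiling.step (tiling p) ≡ Tiling.step (tiling q) → p ≡ q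
  step-injective odds          odds          _ = refl
  step-injective oddMultiples  oddMultiples  _ = refl
  step-injective nearMultiples nearMultiples _ = refl
  step-injective nearSquare    nearSquare    _ = refl
  step-injective odds          oddMultiples  eq = ⊥-elim (ℕ.<⇒≢ 2<4m (sym eq))
  step-injective odds          nearMultiples eq = ⊥-elim (ℕ.<⇒≢ 4<4m (sym eq))
  step-injective odds          nearSquare    eq = ⊥-elim (ℕ.<⇒≢ 2m<4m (sym eq))
  step-injective oddMultiples  odds          eq = ⊥-elim (ℕ.<⇒≢ 2<4m eq)
  step-injective oddMultiples  nearMultiples ()
  step-injective oddMultiples  nearSquare    eq = ⊥-elim (ℕ.<⇒≢ 2<2m eq)
  step-injective nearMultiples odds          eq = ⊥-elim (ℕ.<⇒≢ 4<4m eq)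
  step-injective nearMultiples oddMultiples  ()
  step-injective nearMultiples nearSquare    eq = ⊥-elim (ℕ.<⇒≢ 4<2m eq)
  step-injective nearSquare    odds          eq = ⊥-elim (ℕ.<⇒≢ 2m<4m eq)
  step-injective nearSquare    oddMultiples  eq = ⊥-elim (ℕ.<⇒≢ 2<2m (sym eq))
  step-injective nearSquare    nearMultiples eq = ⊥-elim (ℕ.<⇒≢ 4<2m (sym eq))

  classes-agree : ∀ sw sw' p p' η η' {d} → Admissible p η → Admissible p' η' →
    ShiftedValues (antidiagValues (class sw p η)) (antidiagValues (class sw' p' η')) d →
    ShiftedValues (diagValues (class sw' p' η')) (diagValues (class sw p η)) d →
    sw ≡ sw' × p ≡ p' × (∀ k → k < m → η k ≡ η' k) × d ≡ + 0
  classes-agree false false p p' η η' _ _ anti diag with progression-shift (tiling p') (tiling p) diag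
  ... | same-step , refl with step-injective p' p same-step
  ... | refl = refl , refl , signedBase-cancel (tiling p) η η' anti , refl
  classes-agree true true p p' η η' _ _ anti diag with progression-shift (tiling p) (tiling p') anti
  ... | same-step , refl with step-injective p p' same-step
  ... | refl = refl , refl , (λ k k<m → sym (signedBase-cancel (tiling p) η' η diag k k<m)) , refl
  classes-agree false true p p' η η' adm adm' anti diag = ⊥-elim (crossed-shifts-impossible p p' η η' adm adm' anti diag)
  classes-agree true false p p' η η' adm adm' anti diag =
    ⊥-elim (crossed-shifts-impossible p' p η' η adm' adm (ShiftedValues-flip anti) (ShiftedValues-flip diag))

  shiftedValues-via : ∀ (f g : ℕ → ℤ) d (σ σ' : Fin m → Fin m) → Injective _≡_ _≡_ σ → Injective _≡_ _≡_ σ' →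
                      (∀ i → f (toℕ (σ i)) ≡ g (toℕ (σ' i)) + d) → ShiftedValues f g d
  shiftedValues-via f g d σ σ' σ-inj σ'-inj f∘σ≡g∘σ'+d = forth , back
    where
    forth : ∀ k → k < m → ∃[ k' ] k' < m × f k ≡ g k' + d
    forth k k<m with injective⇒surjective σ σ-inj (fromℕ< k<m)
    ... | i , σi≡k = toℕ (σ' i) , toℕ<n _ , trans (cong f (sym (trans (cong toℕ σi≡k) (toℕ-fromℕ< k<m)))) (f∘σ≡g∘σ'+d i)
    back : ∀ k' → k' < m → ∃[ k ] k < m × f k ≡ g k' + d
    back k' k'<m with injective⇒surjective σ' σ'-inj (fromℕ< k'<m)
    ... | i , σ'i≡k' = toℕ (σ i) , toℕ<n _ , trans (f∘σ≡g∘σ'+d i) (cong (λ z → g z + d) (trans (cong toℕ σ'i≡k') (toℕ-fromℕ< k'<m)))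

  antidiagValues-injective : ∀ C k k' → k < m → k' < m → antidiagValues C k ≡ antidiagValues C k' → k ≡ k'
  antidiagValues-injective (class false p η) k k' k<m k'<m eq = proj₂ (signedBase-injective (tiling p) (η k) (η k') k k' k<m k'<m eq)
  antidiagValues-injective (class true  p η) k k' k<m k'<m eq = progression-injective (tiling p) k k' k<m k'<m eq

  diagValues-injective : ∀ C k k' → k < m → k' < m → diagValues C k ≡ diagValues C k' → k ≡ k'
  diagValues-injective (class false p η) k k' k<m k'<m eq = progression-injective (tiling p) k k' k<m k'<m eq
  diagValues-injective (class true  p η) k k' k<m k'<m eq = proj₂ (signedBase-injective (tiling p) (η k) (η k') k k' k<m k'<m eq)

  antidiagValues-cong : ∀ sw p {η η'} k → η k ≡ η' k → antidiagValues (class sw p η) k ≡ antidiagValues (class sw p η') k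
  antidiagValues-cong false p k ηk≡η'k = cong (λ b → sign b ℤ.* base (tiling p) k) ηk≡η'k
  antidiagValues-cong true  p k ηk≡η'k = refl

  diagValues-cong : ∀ sw p {η η'} k → η k ≡ η' k → diagValues (class sw p η) k ≡ diagValues (class sw p η') k
  diagValues-cong false p k ηk≡η'k = refl
  diagValues-cong true  p k ηk≡η'k = cong (λ b → sign b ℤ.* base (tiling p) k) ηk≡η'k

  classLabeling-cancel : ∀ C C' σ τ σ' τ' → Admissible (Class.shape C) (Class.η C) → Admissible (Class.shape C') (Class.η C') →
    Injective _≡_ _≡_ σ → Injective _≡_ _≡_ τ → Injective _≡_ _≡_ σ' → Injective _≡_ _≡_ τ' →
    (∀ v → classLabeling C σ τ v ≡ classLabeling C' σ' τ' v) →
    Class.swapped C ≡ Class.swapped C' × Class.shape C ≡ Class.shape C' × (∀ k → k < m → Class.η C k ≡ Class.η C' k) ×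
    (∀ i → σ i ≡ σ' i) × (∀ i → τ i ≡ τ' i)
  classLabeling-cancel C@(class sw p η) C'@(class sw' p' η') σ τ σ' τ' adm adm' σ-inj τ-inj σ'-inj τ'-inj same
    with labeling-shift (antidiagValues C ∘ toℕ ∘ σ) (diagValues C ∘ toℕ ∘ τ) (antidiagValues C' ∘ toℕ ∘ σ') (diagValues C' ∘ toℕ ∘ τ') same
  ... | d , anti-shift , diag-shift
    with classes-agree sw sw' p p' η η' adm adm'
           (shiftedValues-via (antidiagValues C) (antidiagValues C') d σ σ' σ-inj σ'-inj anti-shift)
           (shiftedValues-via (diagValues C') (diagValues C) d τ' τ τ'-inj τ-inj diag-shift)
  ... | refl , refl , η≗η' , refl = refl , refl , η≗η' , σ≗σ' , τ≗τ'
    where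
    σ≗σ' : ∀ i → σ i ≡ σ' i
    σ≗σ' i = toℕ-injective (antidiagValues-injective C _ _ (toℕ<n (σ i)) (toℕ<n (σ' i))
      (trans (anti-shift i) (trans (ℤ.+-identityʳ _) (sym (antidiagValues-cong sw p (toℕ (σ' i)) (η≗η' _ (toℕ<n (σ' i))))))))
    τ≗τ' : ∀ i → τ i ≡ τ' i
    τ≗τ' i = toℕ-injective (diagValues-injective C _ _ (toℕ<n (τ i)) (toℕ<n (τ' i))
      (sym (trans (diagValues-cong sw p (toℕ (τ' i)) (η≗η' _ (toℕ<n (τ' i)))) (trans (diag-shift i) (ℤ.+-identityʳ _)))))

module Counting (r : ℕ) (1≤r : 1 ≤ r) where
  open import Data.Nat as ℕ using (ℕ; zero; suc; _≤_; _<_; s≤s; z≤n; _!; _^_; _∸_; _+_; _*_)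
  open import Defs
  open Enumeration
  open Labeling r 1≤r using (c; m)
  open Tilings r 1≤r
  open Family r 1≤r
  open Separation r 1≤r using (Admissible)
  open Distinctness r 1≤r
  import Data.Nat.Properties as ℕ
  import Data.Nat.Tactic.RingSolver as ℕ-Solver
  open import Data.Integer using (ℤ)
  open import Data.Fin using (Fin; zero; suc; toℕ)
  open import Data.Fin.Properties using (toℕ-injective; toℕ<n; *↔×; +↔⊎; 2↔Bool)
  open import Data.Bool using (Bool)
  open import Data.Product using (_×_; _,_)
  open import Data.Product.Function.NonDependent.Propositional using (_×-↔_)
  open import Data.Sum using (_⊎_; inj₁; inj₂)
  open import Data.Sum.Function.Propositional using (_⊎-↔_)
  open import Data.Unit using (tt)
  open import Data.Empty using (⊥-elim)
  open import Function using (_↔_; Inverse)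
  open import Function.Properties.Inverse using (↔-refl; ↔-trans)
  open import Function.Definitions using (Injective)
  open import Relation.Binary.PropositionalEquality

  K K' : ℕ
  K = 2 ^ m
  K' = K ∸ 2

  K≡2+K' : K ≡ 2 + K'
  K≡2+K' = sym (ℕ.m+[n∸m]≡n (ℕ.*-monoʳ-≤ 2 (ℕ.m^n>0 2 c)))

  -- oddMultiples with any of the 2^m sign patterns bit j, or another shape with a
  -- non-constant pattern bit (1 + j), 1 + j < 2^m − 1.
  Pattern : Set
  Pattern = Fin K ⊎ (Fin 3 × Fin K')

  Choice : Set
  Choice = (Bool × Pattern) × (Fin (m !) × Fin (m !))

  count≡ : 4 * m ^ 2 * (2 ^ (m + 1) ∸ 3) * ((m ∸ 1) !) ^ 2 ≡ (2 * (K + 3 * K')) * (m ! * m !)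
  count≡ = begin
    4 * m ^ 2 * (2 ^ (m + 1) ∸ 3) * (c !) ^ 2         ≡⟨ cong (λ x → 4 * m ^ 2 * x * (c !) ^ 2) 2^[m+1]∸3≡1+2K' ⟩
    4 * m ^ 2 * (1 + 2 * K') * (c !) ^ 2              ≡⟨ regroup m K' (c !) ⟩
    (2 * ((2 + K') + 3 * K')) * (m * c ! * (m * c !)) ≡⟨ cong (λ x → (2 * (x + 3 * K')) * (m ! * m !)) K≡2+K' ⟨
    (2 * (K + 3 * K')) * (m ! * m !)                   ∎
    where
    open ≡-Reasoning
    double : ∀ k → 2 * (2 + k) ≡ 3 + (1 + 2 * k)
    double = ℕ-Solver.solve-∀
    2^[m+1]∸3≡1+2K' : 2 ^ (m + 1) ∸ 3 ≡ 1 + 2 * K'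
    2^[m+1]∸3≡1+2K' = begin
      2 ^ (m + 1) ∸ 3        ≡⟨ cong (λ e → 2 ^ e ∸ 3) (ℕ.+-comm m 1) ⟩
      2 * K ∸ 3              ≡⟨ cong (λ x → 2 * x ∸ 3) K≡2+K' ⟩
      2 * (2 + K') ∸ 3       ≡⟨ cong (_∸ 3) (double K') ⟩
      3 + (1 + 2 * K') ∸ 3   ≡⟨ ℕ.m+n∸m≡n 3 (1 + 2 * K') ⟩
      1 + 2 * K'             ∎
    regroup : ∀ m k f → 4 * (m * (m * 1)) * (1 + 2 * k) * (f * (f * 1)) ≡ (2 * ((2 + k) + 3 * k)) * (m * f * (m * f))
    regroup = ℕ-Solver.solve-∀

  choices : Fin ((2 * (K + 3 * K')) * (m ! * m !)) ↔ Choice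
  choices = ↔-trans *↔× ((↔-trans *↔× (2↔Bool ×-↔ ↔-trans +↔⊎ (↔-refl ⊎-↔ *↔×))) ×-↔ *↔×)

  nonconstantShape : Fin 3 → Shape
  nonconstantShape zero             = odds
  nonconstantShape (suc zero)       = nearMultiples
  nonconstantShape (suc (suc zero)) = nearSquare

  classOf : Bool × Pattern → Class
  classOf (sw , inj₁ j)       = class sw oddMultiples (bit (toℕ j))
  classOf (sw , inj₂ (s , j)) = class sw (nonconstantShape s) (bit (suc (toℕ j)))

  private
    3+j≤K : ∀ (j : Fin K') → 3 + toℕ j ≤ K
    3+j≤K j = subst (3 + toℕ j ≤_) (sym K≡2+K') (s≤s (s≤s (toℕ<n j)))

  classOf-admissible : ∀ x → Admissible (Class.shape (classOf x)) (Class.η (classOf x))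
  classOf-admissible (_ , inj₁ _) = tt
  classOf-admissible (_ , inj₂ (zero , j))             = bit-nonconstant m (s≤s z≤n) (3+j≤K j)
  classOf-admissible (_ , inj₂ (suc zero , j))         = bit-nonconstant m (s≤s z≤n) (3+j≤K j)
  classOf-admissible (_ , inj₂ (suc (suc zero) , j))   = bit-nonconstant m (s≤s z≤n) (3+j≤K j)

  private
    nonconstantShape-injective : ∀ s s' → nonconstantShape s ≡ nonconstantShape s' → s ≡ s'
    nonconstantShape-injective zero             zero             _ = refl
    nonconstantShape-injective (suc zero)       (suc zero)       _ = refl
    nonconstantShape-injective (suc (suc zero)) (suc (suc zero)) _ = refl
    nonconstantShape-injective zero             (suc zero)       ()
    nonconstantShape-injective zero             (suc (suc zero)) ()
    nonconstantShape-injective (suc zero)       zero             ()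
    nonconstantShape-injective (suc zero)       (suc (suc zero)) ()
    nonconstantShape-injective (suc (suc zero)) zero             ()
    nonconstantShape-injective (suc (suc zero)) (suc zero)       ()

    oddMultiples≢nonconstantShape : ∀ s → oddMultiples ≢ nonconstantShape s
    oddMultiples≢nonconstantShape zero             ()
    oddMultiples≢nonconstantShape (suc zero)       ()
    oddMultiples≢nonconstantShape (suc (suc zero)) ()

  classOf-cancel : ∀ x y → Class.swapped (classOf x) ≡ Class.swapped (classOf y) → Class.shape (classOf x) ≡ Class.shape (classOf y) →
                   (∀ k → k < m → Class.η (classOf x) k ≡ Class.η (classOf y) k) → x ≡ y
  classOf-cancel (sw , inj₁ j) (sw' , inj₁ j') refl _ same-bits =
    cong (λ i → sw , inj₁ i) (toℕ-injective (bit-injective m (toℕ<n j) (toℕ<n j') same-bits))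
  classOf-cancel (_ , inj₁ _) (_ , inj₂ (s' , _)) _ same-shape _ = ⊥-elim (oddMultiples≢nonconstantShape s' same-shape)
  classOf-cancel (_ , inj₂ (s , _)) (_ , inj₁ _) _ same-shape _ = ⊥-elim (oddMultiples≢nonconstantShape s (sym same-shape))
  classOf-cancel (sw , inj₂ (s , j)) (sw' , inj₂ (s' , j')) refl same-shape same-bits
    with nonconstantShape-injective s s' same-shape
  ... | refl = cong (λ i → sw , inj₂ (s , i)) (toℕ-injective (ℕ.suc-injective
                 (bit-injective m (ℕ.<-trans (ℕ.n<1+n _) (3+j≤K j)) (ℕ.<-trans (ℕ.n<1+n _) (3+j≤K j')) same-bits)))

  labelingOf : Choice → V m → ℤ
  labelingOf (x , (a , b)) = classLabeling (classOf x) (permutation m a) (permutation m b)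

  labelingOf-distanceMagic : ∀ ch → IsDistanceMagicLabeling m (labelingOf ch)
  labelingOf-distanceMagic (x , (a , b)) =
    classLabeling-distanceMagic (classOf x) (permutation m a) (permutation m b) (permutation-injective m a) (permutation-injective m b)

  labelingOf-cancel : ∀ ch ch' → (∀ v → labelingOf ch v ≡ labelingOf ch' v) → ch ≡ ch'
  labelingOf-cancel (x , (a , b)) (x' , (a' , b')) same =
    let same-swap , same-shape , same-bits , σ≗σ' , τ≗τ' =
          classLabeling-cancel (classOf x) (classOf x') (permutation m a) (permutation m b) (permutation m a') (permutation m b')
            (classOf-admissible x) (classOf-admissible x')
            (permutation-injective m a) (permutation-injective m b) (permutation-injective m a') (permutation-injective m b') same
    in cong₂ _,_ (classOf-cancel x x' same-swap same-shape same-bits)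
                 (cong₂ _,_ (permutation-cancel m a a' σ≗σ') (permutation-cancel m b b' τ≗τ'))

open import Defs
open import Data.Nat using (ℕ; _≤_; _%_; _+_; _*_; _^_; _∸_; _!)
open import Data.Integer using (ℤ)
open import Data.Fin using (Fin)
open import Data.Product using (_×_; Σ)
open import Relation.Binary.PropositionalEquality using (_≡_)
open import Data.Nat using (suc; s≤s⁻¹; _/_)
import Data.Nat.Properties as ℕ
open import Data.Nat.DivMod using (m≡m%n+[m/n]*n)
open import Data.Product using (_,_; ∃-syntax)
open import Function using (_↔_; Inverse; Injection)
open import Function.Properties.Inverse using (Inverse⇒Injection)
open import Relation.Binary.PropositionalEquality using (refl; sym; trans; cong; subst)

odd⇒≡1+2* : ∀ m → m % 2 ≡ 1 → ∃[ r ] m ≡ suc (2 * r)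
odd⇒≡1+2* m m%2≡1 = m / 2 , trans (m≡m%n+[m/n]*n m 2) (trans (cong (_+ m / 2 * 2) m%2≡1) (cong suc (ℕ.*-comm (m / 2) 2)))

proposition3p9 : (m : ℕ) → 3 ≤ m → m % 2 ≡ 1 →
    Σ (Fin (4 * m ^ 2 * (2 ^ (m + 1) ∸ 3) * ((m ∸ 1) !) ^ 2) → (V m → ℤ)) λ L →
      (∀ i → IsDistanceMagicLabeling m (L i)) ×
      (∀ i j → (∀ v → L i v ≡ L j v) → i ≡ j)
proposition3p9 m 3≤m m-odd with odd⇒≡1+2* m m-odd
... | r , refl = (λ i → labelingOf (Inverse.to choiceIndex i))
               , (λ i → labelingOf-distanceMagic (Inverse.to choiceIndex i))
               , (λ i j same → Injection.injective (Inverse⇒Injection choiceIndex) (labelingOf-cancel _ _ same))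
  where
  open Counting r (ℕ.*-cancelˡ-≤ 2 (s≤s⁻¹ 3≤m))
  choiceIndex : Fin (4 * m ^ 2 * (2 ^ (m + 1) ∸ 3) * ((m ∸ 1) !) ^ 2) ↔ Choice
  choiceIndex = subst (λ n → Fin n ↔ Choice) (sym count≡) choices
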